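{- Let $G$ be a finite simple connected graph with $n$ vertices and maximum degree $\Delta$. Then (a) $c_{\infty}(G)\ge \dfrac{\iota_e n}{\Delta^2-\Delta+\iota_e(\Delta+1)}\ge \dfrac{\iota_e n}{2\Delta^2}$; (b) $c_{\infty}(G)\ge \dfrac{\iota_v n}{3\Delta+\iota_v(\Delta+1)}$; (c) $c_{\infty}(G)\ge \dfrac{\iota_v n}{4\Delta}$, where $\iota_e=\iota_e(G)$ and $\iota_v=\iota_v(G)$.
   Context: For $S\subseteq V(G)$, $\partial S$ is the set of edges with exactly one endpoint in $S$, and $N(S)$ is the set of vertices having a neighbour in $S$. The edge-isoperimetric number is $\iota_e(G)=\min_{0<|S|\le n/2}|\partial S|/|S|$ and the vertex-isoperimetric number is $\iota_v(G)=\min_{0<|S|\le n/2}|N(S)\setminus S|/|S|$. Game with an unbounded-speed robber: on $G$, a set of cops first choose vertices (several may share a vertex), then the robber, knowing their positions, chooses a vertex. Then the cops and robber move alternately, cops first. Each cop moves to an adjacent vertex or stays; the robber may move along any path starting at her vertex that contains no vertex currently occupied by a cop, or stay. The cops win if a cop occupies the robber's vertex. $c_{\infty}(G)$ is the minimum number of cops that guarantees a cop win. -}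

module Defs where

open import Data.Nat using (ℕ; zero; suc; _+_; _*_; _<_; _≤_; _⊔_)
open import Data.Bool using (Bool; true; false; _∧_; not; if_then_else_)
open import Data.Fin using (Fin)
open import Data.Fin.Subset using (Subset; ∣_∣)
open import Data.Vec using (lookup)
open import Data.List using (List; allFin; map; foldr)
open import Data.Nat.ListAction using (sum)
open import Data.Bool.ListAction using (any)
open import Data.Product using (Σ; ∃; _×_; _,_)
open import Data.Sum using (_⊎_)
open import Data.Empty using (⊥)
open import Data.Integer using (+_)
open import Relation.Nullary using (¬_)
open import Relation.Binary.PropositionalEquality using (_≡_)
import Data.Rational as ℚ
open ℚ using (ℚ)

record Graph (n : ℕ) : Set where
  field
    adj    : Fin n → Fin n → Bool
    sym    : ∀ u v → adj u v ≡ adj v u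
    irrefl : ∀ v → adj v v ≡ false
open Graph public

ind : Bool → ℕ
ind true  = 1
ind false = 0

degree : ∀ {n} → Graph n → Fin n → ℕ
degree {n} G v = sum (map (λ u → ind (adj G v u)) (allFin n))

maxDegree : ∀ {n} → Graph n → ℕ
maxDegree {n} G = foldr _⊔_ 0 (map (degree G) (allFin n))

data Reach {n : ℕ} (G : Graph n) (B : Fin n → Set) (r : Fin n) : Fin n → Set where
  here : ¬ B r → Reach G B r r
  step : ∀ {u w} → Reach G B r u → adj G u w ≡ true → ¬ B w → Reach G B r w

Connected : ∀ {n} → Graph n → Set
Connected G = ∀ u v → Reach G (λ _ → ⊥) u v

-- |∂S| : edges with exactly one endpoint in S (each such edge counted once,
-- as the ordered pair (inside endpoint, outside endpoint)).
edgeBoundary : ∀ {n} → Graph n → Subset n → ℕ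
edgeBoundary {n} G S =
  sum (map (λ u → sum (map (λ v →
    ind (lookup S u ∧ not (lookup S v) ∧ adj G u v)) (allFin n))) (allFin n))

vertexBoundary : ∀ {n} → Graph n → Subset n → ℕ
vertexBoundary {n} G S =
  sum (map (λ v → ind (not (lookup S v) ∧
    any (λ u → lookup S u ∧ adj G v u) (allFin n))) (allFin n))

-- a / b as a rational (only used with b > 0)
frac : ℕ → ℕ → ℚ
frac a zero    = ℚ.0ℚ
frac a (suc b) = (+ a) ℚ./ suc b

ratℕ : ℕ → ℚ
ratℕ a = (+ a) ℚ./ 1

IsIsoMin : ∀ {n} → (Subset n → ℕ) → ℚ → Set
IsIsoMin {n} f x =
  (Σ (Subset n) λ S → (0 < ∣ S ∣) × (2 * ∣ S ∣ ≤ n) × (x ≡ frac (f S) ∣ S ∣))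
  × (∀ (S : Subset n) → 0 < ∣ S ∣ → 2 * ∣ S ∣ ≤ n → x ℚ.≤ frac (f S) ∣ S ∣)

IsEdgeIsoNumber : ∀ {n} → Graph n → ℚ → Set
IsEdgeIsoNumber G = IsIsoMin (edgeBoundary G)

IsVertexIsoNumber : ∀ {n} → Graph n → ℚ → Set
IsVertexIsoNumber G = IsIsoMin (vertexBoundary G)

-- Cops and an unbounded-speed robber.  Positions of k cops: Fin k → Fin n.
Occupied : ∀ {n k} → (Fin k → Fin n) → Fin n → Set
Occupied cops v = ∃ λ i → cops i ≡ v

CopMove : ∀ {n k} → Graph n → (Fin k → Fin n) → (Fin k → Fin n) → Set
CopMove G cops cops' = ∀ i → (cops' i ≡ cops i) ⊎ (adj G (cops i) (cops' i) ≡ true)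

-- CopsForceWin G cops r : it is the cops' turn, cops at `cops`, robber at r,
-- and the cops can force a capture (inductively: least fixed point).
data CopsForceWin {n k : ℕ} (G : Graph n) : (Fin k → Fin n) → Fin n → Set where
  caught : ∀ {cops r} → Occupied cops r → CopsForceWin G cops r
  move   : ∀ {cops r} (cops' : Fin k → Fin n) → CopMove G cops cops'
         → (∀ r' → Reach G (Occupied cops') r r' → CopsForceWin G cops' r')
         → CopsForceWin G cops r

-- k cops guarantee a win: they choose initial positions, the robber then
-- chooses any vertex, and the cops (moving first) can force a capture.
CopsWin : ∀ {n} → Graph n → ℕ → Set
CopsWin {n} G k = Σ (Fin k → Fin n) λ cops → ∀ r → CopsForceWin G cops r

IsCopNumberInf : ∀ {n} → Graph n → ℕ → Set
IsCopNumberInf G c = CopsWin G c × (∀ k → CopsWin G k → c ≤ k)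

module Submission where

-- If c cops can catch the robber, some placement C of the cops leaves every component of
-- G − N[C] with at most n/2 vertices. Otherwise the robber always stays in a component of
-- G − N[C] with more than half of the vertices: the cops move inside N[C], so this component
-- meets the large component for their new placement, and she runs through the intersection. Every vertex is a cop vertex (at most c of them), in the frontier N(C) ∖ C
-- (at most cΔ) or free. (a) Each component A has ι_e|A| ≤ |∂A| and all these edges end in the
-- frontier, where each vertex spends one edge on a cop, so ι_e·|free| ≤ (Δ − 1)cΔ.
-- (b) Merging components one at a time yields a union of components, or its complement among
-- the free vertices, with between |free|/3 and n/2 vertices and vertex boundary inside the
-- frontier, so ι_v·|free| ≤ 3cΔ. (c) Merging components onto the cop vertices likewise gives
-- such a set with at least n/4 vertices, unless 2cΔ ≥ n, where ι_v ≤ 2 already suffices.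

open import Defs hiding (sym)

module NaturalBounds where

  open import Data.Nat using (ℕ; zero; suc; _+_; _*_; _∸_; _≤_; _<_; z≤n; s≤s; _≤?_; _<?_; _<ᵇ_; _⊔_; >-nonZero)
  open import Data.Nat.Properties hiding (_≟_)
  open import Data.Nat.DivMod using (_/_; _%_; m≡m%n+[m/n]*n; m%n<n; m/n*n≤m)
  open import Data.Nat.Solver using (module +-*-Solver)
  open +-*-Solver using (solve; _:+_; _:*_; _:=_; con)
  open import Algebra.Properties.Semiring.Sum +-*-semiring
    using (sum; sum-cong-≗; ∑-comm; ∑-distrib-+; *-distribˡ-sum)
  open import Data.Bool using (Bool; true; false; _∧_; _∨_; not) renaming (_≟_ to _≟ᵇ_)
  open import Data.Bool.Properties using (∧-distribʳ-∨; ∧-zeroʳ; T-≡; not-injective; not-¬; ¬-not)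
  open import Data.Fin using (Fin; zero; suc; toℕ)
  open import Data.Fin.Subset using (Subset; ∣_∣)
  open import Data.Vec using ([]; _∷_; lookup)
  import Data.Vec as Vec
  open import Data.Vec.Properties using (lookup∘tabulate)
  open import Data.Fin.Properties using (any?; _≟_; ¬∀⟶∃¬)
  open import Data.List using (List; []; _∷_; map; foldr; tabulate; allFin)
  open import Data.List.Relation.Unary.Any using (here; there; satisfied)
  open import Data.List.Relation.Unary.Any.Properties using (any⁻)
  open import Data.List.Membership.Propositional using (_∈_)
  open import Data.List.Membership.Propositional.Properties using (∈-allFin)
  import Data.List.Properties as List
  import Data.Nat.ListAction as List using (sum)
  open import Data.Bool.ListAction using (any; or)
  import Data.Product
  open import Data.Product using (Σ; ∃; ∃₂; _×_; _,_; proj₁; proj₂)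
  open import Data.Sum using (_⊎_; inj₁; inj₂; [_,_]′)
  open import Data.Empty using (⊥; ⊥-elim)
  open import Function using (_∘_; Equivalence)
  open import Relation.Nullary using (¬_; Dec; yes; no; does)
  open import Relation.Nullary.Decidable using (dec-true; decidable-stable)
  open import Relation.Binary.PropositionalEquality

  sum-mono-≤ : ∀ {m} {f g : Fin m → ℕ} → (∀ i → f i ≤ g i) → sum f ≤ sum g
  sum-mono-≤ {zero}  f≤g = z≤n
  sum-mono-≤ {suc m} f≤g = +-mono-≤ (f≤g zero) (sum-mono-≤ (f≤g ∘ suc))

  sum-mono-< : ∀ {m} {f g : Fin m → ℕ} → (∀ i → f i ≤ g i) → ∀ j → f j < g j → sum f < sum g
  sum-mono-< f≤g zero    lt = +-mono-<-≤ lt (sum-mono-≤ (f≤g ∘ suc))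
  sum-mono-< f≤g (suc j) lt = +-mono-≤-< (f≤g zero) (sum-mono-< (f≤g ∘ suc) j lt)

  term≤sum : ∀ {m} (f : Fin m → ℕ) i → f i ≤ sum f
  term≤sum f zero    = m≤m+n _ _
  term≤sum f (suc i) = ≤-trans (term≤sum (f ∘ suc) i) (m≤n+m _ (f zero))

  sum-const : ∀ m k → sum {m} (λ _ → k) ≡ m * k
  sum-const zero    k = refl
  sum-const (suc m) k = cong (k +_) (sum-const m k)

  sum-zero : ∀ {m} (f : Fin m → ℕ) → (∀ i → f i ≡ 0) → sum f ≡ 0
  sum-zero {m} f f≡0 = trans (sum-cong-≗ f≡0) (trans (sum-const m 0) (*-zeroʳ m))

  listSum-allFin : ∀ {m} (f : Fin m → ℕ) → List.sum (map f (allFin m)) ≡ sum f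
  listSum-allFin {m} f = trans (cong List.sum (List.map-tabulate (λ i → i) f)) (sum-tabulate m f)
    where
    sum-tabulate : ∀ m (f : Fin m → ℕ) → List.sum (tabulate f) ≡ sum f
    sum-tabulate zero    f = refl
    sum-tabulate (suc m) f = cong (f zero +_) (sum-tabulate m (f ∘ suc))

  ∧-true⁻ : ∀ {a b} → a ∧ b ≡ true → a ≡ true × b ≡ true
  ∧-true⁻ {true} {true} _ = refl , refl

  ∨-true⁻ : ∀ {a b} → a ∨ b ≡ true → a ≡ true ⊎ b ≡ true
  ∨-true⁻ {true}  _ = inj₁ refl
  ∨-true⁻ {false} b = inj₂ b

  ∨-trueˡ : ∀ {a} b → a ≡ true → a ∨ b ≡ true
  ∨-trueˡ b refl = refl

  ∨-trueʳ : ∀ a {b} → b ≡ true → a ∨ b ≡ true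
  ∨-trueʳ true  _ = refl
  ∨-trueʳ false b = b

  ∨-false⁻ : ∀ {a b} → a ∨ b ≡ false → a ≡ false × b ≡ false
  ∨-false⁻ {false} b = refl , b

  any-true⁻ : ∀ {A : Set} (p : A → Bool) xs → any p xs ≡ true → ∃ λ x → p x ≡ true
  any-true⁻ p xs found = Data.Product.map₂ (Equivalence.to T-≡) (satisfied (any⁻ p xs (Equivalence.from T-≡ found)))

  ind-mono : ∀ {a b} → (a ≡ true → b ≡ true) → ind a ≤ ind b
  ind-mono {false} _   = z≤n
  ind-mono {true}  a⇒b rewrite a⇒b refl = ≤-refl

  ind-∨ : ∀ a b → ind (a ∨ b) ≤ ind a + ind b
  ind-∨ true  _ = s≤s z≤n
  ind-∨ false _ = ≤-refl

  ind-∨-disjoint : ∀ a b → (a ≡ true → b ≡ false) → ind (a ∨ b) ≡ ind a + ind b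
  ind-∨-disjoint true  _ a⇒¬b rewrite a⇒¬b refl = refl
  ind-∨-disjoint false _ _ = refl

  -- Kept opaque: unfolding `count` during unification makes elaboration blow up.
  opaque
    count : ∀ {n} → (Fin n → Bool) → ℕ
    count P = sum (ind ∘ P)

    count≡sum : ∀ {n} (P : Fin n → Bool) → count P ≡ sum (ind ∘ P)
    count≡sum P = refl

    count-≗ : ∀ {n} {P Q : Fin n → Bool} → (∀ v → P v ≡ Q v) → count P ≡ count Q
    count-≗ P≗Q = sum-cong-≗ (cong ind ∘ P≗Q)

    count-∅ : ∀ {n} → count {n} (λ _ → false) ≡ 0
    count-∅ {n} = sum-zero {n} (λ _ → 0) (λ _ → refl)

    count-mono : ∀ {n} {P Q : Fin n → Bool} → (∀ v → P v ≡ true → Q v ≡ true) → count P ≤ count Q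
    count-mono P⊆Q = sum-mono-≤ (ind-mono ∘ P⊆Q)

    count≤n : ∀ {n} (P : Fin n → Bool) → count P ≤ n
    count≤n {n} P = ≤-trans (count-mono {P = P} {Q = λ _ → true} (λ _ _ → refl))
                        (≤-reflexive (trans (sum-const n 1) (*-identityʳ n)))

    count-mono-< : ∀ {n} {P Q : Fin n → Bool} → (∀ v → P v ≡ true → Q v ≡ true)
                 → ∀ w → P w ≡ false → Q w ≡ true → count P < count Q
    count-mono-< {P = P} {Q} P⊆Q w ¬Pw Qw = sum-mono-< (ind-mono ∘ P⊆Q) w strict
      where
      strict : ind (P w) < ind (Q w)
      strict rewrite ¬Pw | Qw = s≤s z≤n

    count-pos : ∀ {n} (P : Fin n → Bool) {v} → P v ≡ true → 1 ≤ count P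
    count-pos P {v} Pv = ≤-trans (≤-reflexive (cong ind (sym Pv))) (term≤sum (ind ∘ P) v)

    count-∨ : ∀ {n} (P Q : Fin n → Bool) → count (λ v → P v ∨ Q v) ≤ count P + count Q
    count-∨ P Q = ≤-trans (sum-mono-≤ (λ v → ind-∨ (P v) (Q v))) (≤-reflexive (∑-distrib-+ (ind ∘ P) (ind ∘ Q)))

    count-∨-disjoint : ∀ {n} (P Q : Fin n → Bool) → (∀ v → P v ≡ true → Q v ≡ false)
                     → count (λ v → P v ∨ Q v) ≡ count P + count Q
    count-∨-disjoint P Q disj =
      trans (sum-cong-≗ (λ v → ind-∨-disjoint (P v) (Q v) (disj v))) (∑-distrib-+ (ind ∘ P) (ind ∘ Q))

    count-complement : ∀ {n} (P : Fin n → Bool) → count P + count (not ∘ P) ≡ n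
    count-complement {n} P = begin
      count P + count (not ∘ P)          ≡⟨ count-∨-disjoint P (not ∘ P) (λ v Pv → cong not Pv) ⟨
      count (λ v → P v ∨ not (P v))      ≡⟨ count-≗ (λ v → ∨-not (P v)) ⟩
      count {n} (λ _ → true)             ≡⟨ trans (sum-const n 1) (*-identityʳ n) ⟩
      n                                  ∎
      where
      open ≡-Reasoning
      ∨-not : ∀ b → b ∨ not b ≡ true
      ∨-not true  = refl
      ∨-not false = refl

    count-covered : ∀ {n m} (P : Fin n → Bool) (Q : Fin m → Fin n → Bool)
                  → (∀ v → P v ≡ true → ∃ λ i → Q i v ≡ true) → count P ≤ sum (λ i → count (Q i))
    count-covered P Q cover = ≤-trans (sum-mono-≤ covered) (≤-reflexive (∑-comm (λ v i → ind (Q i v))))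
      where
      covered : ∀ v → ind (P v) ≤ sum (λ i → ind (Q i v))
      covered v with P v in Pv
      ... | false = z≤n
      ... | true with cover v Pv
      ... | i , Qiv = ≤-trans (≤-reflexive (cong ind (sym Qiv))) (term≤sum (λ i → ind (Q i v)) i)

    count-≟ : ∀ {n} (c : Fin n) → count (λ v → does (c ≟ v)) ≡ 1
    count-≟ {suc n} zero    = cong suc (sum-zero {n} (λ v → ind (does (zero ≟ suc v))) (λ _ → refl))
    count-≟ {suc n} (suc c) = count-≟ c

  large-sets-meet : ∀ {n} (P Q : Fin n → Bool) → n < count P + count Q → ∃ λ v → P v ≡ true × Q v ≡ true
  large-sets-meet {n} P Q n<P+Q with any? (λ v → P v ∧ Q v ≟ᵇ true)
  ... | yes (v , PQv) = v , ∧-true⁻ PQv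
  ... | no ¬PQ = ⊥-elim (<⇒≱ n<P+Q (begin
    count P + count Q              ≡⟨ count-∨-disjoint P Q disjoint ⟨
    count (λ v → P v ∨ Q v)        ≤⟨ count≤n _ ⟩
    n                              ∎))
    where
    open ≤-Reasoning
    disjoint : ∀ v → P v ≡ true → Q v ≡ false
    disjoint v Pv with Q v in Qv
    ... | true  = ⊥-elim (¬PQ (v , cong₂ _∧_ Pv Qv))
    ... | false = refl

  module Paths {n : ℕ} (G : Graph n) where

    Reach-start : ∀ {B : Fin n → Set} {r w} → Reach G B r w → ¬ B r
    Reach-start (here ¬Br)   = ¬Br
    Reach-start (step p _ _) = Reach-start p

    Reach-end : ∀ {B : Fin n → Set} {r w} → Reach G B r w → ¬ B w
    Reach-end (here ¬Bw)      = ¬Bw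
    Reach-end (step _ _ ¬Bw) = ¬Bw

    Reach-trans : ∀ {B : Fin n → Set} {r u w} → Reach G B r u → Reach G B u w → Reach G B r w
    Reach-trans p (here _)         = p
    Reach-trans p (step q uw ¬Bw) = step (Reach-trans p q) uw ¬Bw

    Reach-sym : ∀ {B : Fin n → Set} {r w} → Reach G B r w → Reach G B w r
    Reach-sym (here ¬Br)                   = here ¬Br
    Reach-sym (step {u} {w} p uw ¬Bw) =
      Reach-trans (step (here ¬Bw) (trans (Graph.sym G w u) uw) (Reach-end p)) (Reach-sym p)

    Reach-mono : ∀ {B B′ : Fin n → Set} → (∀ v → B′ v → B v) → ∀ {r w} → Reach G B r w → Reach G B′ r w
    Reach-mono B′⊆B (here ¬Br)       = here (¬Br ∘ B′⊆B _)
    Reach-mono B′⊆B (step p uw ¬Bw) = step (Reach-mono B′⊆B p) uw (¬Bw ∘ B′⊆B _)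

    module _ (X : Fin n → Bool) where

      private
        Blocked : Fin n → Set
        Blocked v = X v ≡ true

        Closed : (Fin n → Bool) → Set
        Closed A = ∀ {u w} → A u ≡ true → adj G u w ≡ true → X w ≡ false → A w ≡ true

        ReachableFrom : Fin n → (Fin n → Bool) → Set
        ReachableFrom r A = ∀ {w} → A w ≡ true → Reach G Blocked r w

        expand : (Fin n → Bool) → Fin n → Bool
        expand A w = A w ∨ (not (X w) ∧ does (any? λ u → A u ∧ adj G u w ≟ᵇ true))

        ⊆-expand : ∀ A w → A w ≡ true → expand A w ≡ true
        ⊆-expand A w Aw = ∨-trueˡ _ Aw

        expand-reachable : ∀ {r A} → ReachableFrom r A → ReachableFrom r (expand A)
        expand-reachable {A = A} reach {w} Aw′
          with A w in Aw | X w in Xw | any? (λ u → A u ∧ adj G u w ≟ᵇ true)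
        ... | true  | _     | _               = reach Aw
        ... | false | false | yes (u , found) =
          step (reach (proj₁ (∧-true⁻ found))) (proj₂ (∧-true⁻ found)) (λ Xw′ → not-¬ Xw′ Xw)
        expand-reachable reach () | false | true  | _
        expand-reachable reach () | false | false | no _

        closed-or-expands : ∀ A → Closed A ⊎ count A < count (expand A)
        closed-or-expands A with any? (λ w → expand A w ∧ not (A w) ≟ᵇ true)
        ... | yes (w , new) = inj₂ (count-mono-< (⊆-expand A) w (not-injective (proj₂ (∧-true⁻ new))) (proj₁ (∧-true⁻ new)))
        ... | no none = inj₁ closed
          where
          closed : Closed A
          closed {u} {w} Au uw Xw with A w in Aw
          ... | true  = refl
          ... | false = ⊥-elim (none (w , subst (λ b → expand A w ∧ not b ≡ true) (sym Aw) (cong (_∧ true) expanded)))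
            where
            expanded : expand A w ≡ true
            expanded = ∨-trueʳ (A w)
              (subst (λ x → not x ∧ _ ≡ true) (sym Xw) (dec-true (any? _) (u , cong₂ _∧_ Au uw)))

        closure : ∀ {r} m A → n < count A + m → ReachableFrom r A
                → Σ (Fin n → Bool) λ B → Closed B × (∀ v → A v ≡ true → B v ≡ true) × ReachableFrom r B
        closure m A bound reach with closed-or-expands A
        ... | inj₁ closed = A , closed , (λ _ Av → Av) , reach
        closure zero A bound reach | inj₂ _ =
          ⊥-elim (<⇒≱ bound (≤-trans (≤-reflexive (+-identityʳ _)) (count≤n A)))
        closure (suc m) A bound reach | inj₂ grows
          with closure m (expand A) (≤-trans bound (≤-trans (≤-reflexive (+-suc (count A) m)) (+-monoˡ-≤ m grows)))
                       (expand-reachable reach)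
        ... | B , closed , expand⊆B , reachB = B , closed , (λ v Av → expand⊆B v (⊆-expand A v Av)) , reachB

        singleton : Fin n → Fin n → Bool
        singleton r v = does (r ≟ v) ∧ not (X v)

        singleton-self : ∀ {r} → ¬ Blocked r → singleton r r ≡ true
        singleton-self {r} ¬Xr rewrite dec-true (r ≟ r) refl | ¬-not ¬Xr = refl

        singleton-reachable : ∀ r → ReachableFrom r (singleton r)
        singleton-reachable r {w} r∈ with r ≟ w | ∧-true⁻ {does (r ≟ w)} r∈
        ... | yes refl | _ , ¬Xr = here (λ Xr → not-¬ Xr (not-injective ¬Xr))

      Reach? : ∀ r w → Dec (Reach G (λ v → X v ≡ true) r w)
      Reach? r w with closure (suc n) (singleton r) (≤-trans (s≤s (m≤n+m n _)) (≤-reflexive (sym (+-suc _ n))))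
                              (singleton-reachable r)
      ... | B , closed , r∈B , reachB with B w in Bw
      ... | true  = yes (reachB Bw)
      ... | false = no (λ p → not-¬ (reached p) Bw)
        where
        reached : ∀ {v} → Reach G Blocked r v → B v ≡ true
        reached (here ¬Xr)       = r∈B r (singleton-self ¬Xr)
        reached (step p uv ¬Xv) = closed (reached p) uv (¬-not ¬Xv)

  ≤-foldr-⊔ : ∀ {A : Set} (f : A → ℕ) {x xs} → x ∈ xs → f x ≤ foldr _⊔_ 0 (map f xs)
  ≤-foldr-⊔ f (here refl)               = m≤m⊔n _ _
  ≤-foldr-⊔ f {xs = y ∷ _} (there x∈xs) = m≤n⇒m≤o⊔n (f y) (≤-foldr-⊔ f x∈xs)

  degree≤maxDegree : ∀ {n} (G : Graph n) v → count (adj G v) ≤ maxDegree G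
  degree≤maxDegree G v = ≤-trans (≤-reflexive (trans (count≡sum (adj G v)) (sym (listSum-allFin (ind ∘ adj G v)))))
                                 (≤-foldr-⊔ (degree G) (∈-allFin v))

  connected⇒1≤maxDegree : ∀ {n} (G : Graph n) → Connected G → 2 ≤ n → 1 ≤ maxDegree G
  connected⇒1≤maxDegree {suc zero}    G conn (s≤s ())
  connected⇒1≤maxDegree {suc (suc _)} G conn _ with conn zero (suc zero)
  ... | step {u} _ u~1 _ = ≤-trans (count-pos (adj G u) u~1) (degree≤maxDegree G u)

  -- Cop placements and the robber's escape

  <-+-doubled : ∀ {m} a b → m < a + a → m < b + b → m < a + b
  <-+-doubled a b m<2a m<2b with ≤-total a b
  ... | inj₁ a≤b = ≤-trans m<2a (+-monoʳ-≤ a a≤b)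
  ... | inj₂ b≤a = ≤-trans m<2b (+-monoˡ-≤ b b≤a)

  module Configuration {n : ℕ} (G : Graph n) {k : ℕ} (C : Fin k → Fin n) where
    open Paths G

    -- guarded is the closed neighbourhood N[C] of the cops, frontier is N(C) ∖ C, free is V ∖ N[C].
    occupied : Fin n → Bool
    occupied v = does (any? λ i → C i ≟ v)

    guarded : Fin n → Bool
    guarded v = occupied v ∨ does (any? λ i → adj G (C i) v ≟ᵇ true)

    frontier : Fin n → Bool
    frontier v = guarded v ∧ not (occupied v)

    free : Fin n → Bool
    free v = not (guarded v)

    component : Fin n → Fin n → Bool
    component r w = does (Reach? guarded r w)

    Occupied⇒guarded : ∀ {v} → Occupied C v → guarded v ≡ true
    Occupied⇒guarded occ = ∨-trueˡ _ (dec-true (any? _) occ)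

    occupied⁻ : ∀ {v} → occupied v ≡ true → Occupied C v
    occupied⁻ {v} occ with any? (λ i → C i ≟ v)
    ... | yes found = found

    guarded⁻ : ∀ {v} → guarded v ≡ true → occupied v ≡ false → ∃ λ i → adj G (C i) v ≡ true
    guarded⁻ {v} grd ¬occ with any? (λ i → adj G (C i) v ≟ᵇ true)
    ... | yes found = found
    ... | no _ rewrite ¬occ = ⊥-elim (not-¬ grd refl)

    Occupied-neighbour-guarded : ∀ {u v} → Occupied C u → adj G u v ≡ true → guarded v ≡ true
    Occupied-neighbour-guarded (i , refl) uv = ∨-trueʳ _ (dec-true (any? _) (i , uv))

    component-Reach : ∀ {r w} → component r w ≡ true → Reach G (λ v → guarded v ≡ true) r w
    component-Reach {r} {w} r~w with Reach? guarded r w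
    ... | yes p = p

    AllComponentsSmall : Set
    AllComponentsSmall = ∀ r → count (component r) + count (component r) ≤ n

  module _ {n : ℕ} (G : Graph n) {k : ℕ} where
    open Paths G
    open Configuration using (component; component-Reach; Occupied⇒guarded; AllComponentsSmall)

    moved-into-guarded : ∀ {C C′ : Fin k → Fin n} → CopMove G C C′
                       → ∀ v → Occupied C′ v → Configuration.guarded G C v ≡ true
    moved-into-guarded {C} moves v (i , C′i≡v) with moves i
    ... | inj₁ stayed = Occupied⇒guarded G C (i , trans (sym stayed) C′i≡v)
    ... | inj₂ C→C′ = ∨-trueʳ _ (dec-true (any? _) (i , subst (λ u → adj G (C i) u ≡ true) C′i≡v C→C′))

    robber-evades : (∀ (C : Fin k → Fin n) → ∃ λ r → n < count (component G C r) + count (component G C r))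
                  → ¬ CopsWin G k
    robber-evades largeComponent (C₀ , win) = evade (win r₀) large₀
      where
      r₀ = proj₁ (largeComponent C₀)
      large₀ = proj₂ (largeComponent C₀)
      evade : ∀ {C r} → CopsForceWin G C r → n < count (component G C r) + count (component G C r) → ⊥
      evade {C} {r} (caught occ) large with large-sets-meet (component G C r) (component G C r) large
      ... | _ , r~v , _ = Reach-start (component-Reach G C r~v) (Occupied⇒guarded G C occ)
      evade {C} {r} (move C′ moves next) large with largeComponent C′
      ... | r′ , large′
        with large-sets-meet (component G C r) (component G C′ r′)
               (<-+-doubled (count (component G C r)) (count (component G C′ r′)) large large′)
      ... | v , r~v , r′~v = evade (next r′ (Reach-trans r⇝v v⇝r′)) large′
        where
        r⇝v  = Reach-mono (moved-into-guarded moves) (component-Reach G C r~v)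
        v⇝r′ = Reach-mono (λ u → Occupied⇒guarded G C′) (Reach-sym (component-Reach G C′ r′~v))

    cops-win⇒small-configuration : CopsWin G k → ¬ ¬ ∃ (AllComponentsSmall G {k})
    cops-win⇒small-configuration win noneSmall = robber-evades largeComponent win
      where
      largeComponent : ∀ C → ∃ λ r → n < count (component G C r) + count (component G C r)
      largeComponent C with ¬∀⟶∃¬ n _ (λ r → _ ≤? n) (λ small → noneSmall (C , small))
      ... | r , ¬small = r , ≰⇒> ¬small

    -- The robber only refutes the absence of a good placement; a decidable goal makes that enough.
    bound-from-small-configuration : ∀ {I : Set} → Dec I → CopsWin G k
                                   → (∀ C → AllComponentsSmall G C → I) → I
    bound-from-small-configuration I? win bound =
      decidable-stable I? (λ ¬I → cops-win⇒small-configuration win (λ (C , small) → ¬I (bound C small)))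

  -- Sets whose boundary lies in the frontier

  module Neighbourhood {n : ℕ} (G : Graph n) {k : ℕ} (C : Fin k → Fin n) where
    open Paths G
    open Configuration G C

    count-occupied≤ : count occupied ≤ k
    count-occupied≤ = begin
      count occupied                            ≤⟨ count-covered occupied (λ i v → does (C i ≟ v)) cover ⟩
      sum (λ i → count (λ v → does (C i ≟ v))) ≡⟨ sum-cong-≗ (count-≟ ∘ C) ⟩
      sum {k} (λ _ → 1)                         ≡⟨ trans (sum-const k 1) (*-identityʳ k) ⟩
      k                                         ∎
      where
      open ≤-Reasoning
      cover : ∀ v → occupied v ≡ true → ∃ λ i → does (C i ≟ v) ≡ true
      cover v occ with occupied⁻ occ
      ... | i , Ci≡v = i , dec-true (C i ≟ v) Ci≡v

    count-frontier≤ : count frontier ≤ k * maxDegree G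
    count-frontier≤ = begin
      count frontier                      ≤⟨ count-covered frontier (λ i → adj G (C i)) cover ⟩
      sum (λ i → count (adj G (C i)))     ≤⟨ sum-mono-≤ (λ i → degree≤maxDegree G (C i)) ⟩
      sum {k} (λ _ → maxDegree G)         ≡⟨ sum-const k (maxDegree G) ⟩
      k * maxDegree G                     ∎
      where
      open ≤-Reasoning
      cover : ∀ v → frontier v ≡ true → ∃ λ i → adj G (C i) v ≡ true
      cover v fr with ∧-true⁻ {guarded v} fr
      ... | grd , ¬occ = guarded⁻ grd (not-injective ¬occ)

    n≤occupied+frontier+free : n ≤ count occupied + count frontier + count free
    n≤occupied+frontier+free = begin
      n                                         ≡⟨ count-complement guarded ⟨
      count guarded + count free                ≤⟨ +-monoˡ-≤ (count free) (≤-trans (count-mono split) (count-∨ occupied frontier)) ⟩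
      count occupied + count frontier + count free ∎
      where
      open ≤-Reasoning
      split : ∀ v → guarded v ≡ true → occupied v ∨ frontier v ≡ true
      split v grd with occupied v
      ... | true  = refl
      ... | false = cong (_∧ true) grd

    free-neighbour-unoccupied : ∀ {u v} → free u ≡ true → adj G u v ≡ true → occupied v ≡ false
    free-neighbour-unoccupied {u} {v} fu uv with occupied v in occ
    ... | false = refl
    ... | true = ⊥-elim (not-¬ (Occupied-neighbour-guarded (occupied⁻ occ) (trans (Graph.sym G v u) uv))
                                    (not-injective fu))

    unoccupied-guarded-frontier : ∀ {v} → guarded v ≡ true → occupied v ≡ false → frontier v ≡ true
    unoccupied-guarded-frontier grd ¬occ rewrite grd | ¬occ = refl

    ¬free⇒guarded : ∀ {v} → ¬ free v ≡ true → guarded v ≡ true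
    ¬free⇒guarded = not-injective ∘ ¬-not

    -- Unions of components of G − N[C], possibly together with the cop vertices.
    record Saturated (W : Fin n → Bool) : Set where
      field
        closed            : ∀ {u w} → W u ≡ true → free u ≡ true → adj G u w ≡ true → free w ≡ true → W w ≡ true
        exits-to-frontier : ∀ {u v} → W u ≡ true → adj G u v ≡ true → W v ≡ false → frontier v ≡ true
    open Saturated

    component-free : ∀ {r v} → component r v ≡ true → free v ≡ true
    component-free r~v = cong not (¬-not (Reach-end (component-Reach r~v)))

    component-step : ∀ {r u w} → component r u ≡ true → adj G u w ≡ true → free w ≡ true → component r w ≡ true
    component-step {r} {u} {w} r~u uw fw =
      dec-true (Reach? guarded r w) (step (component-Reach r~u) uw (λ gw → not-¬ gw (not-injective fw)))

    component-saturated : ∀ r → Saturated (component r)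
    component-saturated r .closed r~u _ uw fw = component-step r~u uw fw
    component-saturated r .exits-to-frontier r~u uv r≁v =
      unoccupied-guarded-frontier (¬free⇒guarded (λ fv → not-¬ (component-step r~u uv fv) r≁v))
                                  (free-neighbour-unoccupied (component-free r~u) uv)

    occupied-saturated : Saturated occupied
    occupied-saturated .closed occ fu _ _ =
      ⊥-elim (not-¬ (Occupied⇒guarded (occupied⁻ occ)) (not-injective fu))
    occupied-saturated .exits-to-frontier occ uv ¬occ =
      unoccupied-guarded-frontier (Occupied-neighbour-guarded (occupied⁻ occ) uv) ¬occ

    ∨-saturated : ∀ {A W} → Saturated A → Saturated W → Saturated (λ v → A v ∨ W v)
    ∨-saturated {A} {W} satA satW .closed {u} {w} Au∨Wu fu uw fw with ∨-true⁻ {A u} Au∨Wu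
    ... | inj₁ Au = ∨-trueˡ _ (satA .closed Au fu uw fw)
    ... | inj₂ Wu = ∨-trueʳ (A w) (satW .closed Wu fu uw fw)
    ∨-saturated {A} {W} satA satW .exits-to-frontier {u} {v} Au∨Wu uv ¬Av∨Wv
      with ∨-true⁻ {A u} Au∨Wu | ∨-false⁻ {A v} ¬Av∨Wv
    ... | inj₁ Au | ¬Av , _   = satA .exits-to-frontier Au uv ¬Av
    ... | inj₂ Wu | _   , ¬Wv = satW .exits-to-frontier Wu uv ¬Wv

    complement-saturated : ∀ {W} → Saturated W → Saturated (λ v → free v ∧ not (W v))
    complement-saturated {W} satW = record { closed = closed′ ; exits-to-frontier = exits′ }
      where
      outside : ∀ {u v} → free u ≡ true → not (W u) ≡ true → adj G u v ≡ true → free v ≡ true → W v ≡ false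
      outside {u} {v} fu ¬Wu uv fv with W v in Wv
      ... | false = refl
      ... | true  = ⊥-elim (not-¬ (satW .closed Wv fv (trans (Graph.sym G v u) uv) fu) (not-injective ¬Wu))

      closed′ : ∀ {u w} → free u ∧ not (W u) ≡ true → free u ≡ true → adj G u w ≡ true → free w ≡ true
              → free w ∧ not (W w) ≡ true
      closed′ {u} Su _ uw fw with ∧-true⁻ {free u} Su
      ... | fu , ¬Wu rewrite fw | outside fu ¬Wu uw fw = refl

      exits′ : ∀ {u v} → free u ∧ not (W u) ≡ true → adj G u v ≡ true → free v ∧ not (W v) ≡ false
             → frontier v ≡ true
      exits′ {u} {v} Su uv ¬Sv with ∧-true⁻ {free u} Su
      ... | fu , ¬Wu = unoccupied-guarded-frontier (¬free⇒guarded inside) (free-neighbour-unoccupied fu uv)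
        where
        inside : ¬ free v ≡ true
        inside fv = not-¬ (cong₂ (λ a b → a ∧ not b) fv (outside fu ¬Wu uv fv)) ¬Sv

    ∅-saturated : Saturated (λ _ → false)
    ∅-saturated = record { closed = λ () ; exits-to-frontier = λ () }

    unionFrom : (Fin n → Bool) → List (Fin n) → Fin n → Bool
    unionFrom base []       = base
    unionFrom base (r ∷ rs) = λ v → component r v ∨ unionFrom base rs v

    unionFrom-saturated : ∀ {base} → Saturated base → ∀ rs → Saturated (unionFrom base rs)
    unionFrom-saturated sat []       = sat
    unionFrom-saturated sat (r ∷ rs) = ∨-saturated (component-saturated r) (unionFrom-saturated sat rs)

    component⊆unionFrom : ∀ base {r rs v} → r ∈ rs → component r v ≡ true → unionFrom base rs v ≡ true
    component⊆unionFrom base {rs = _ ∷ rs} (here refl) r~v = ∨-trueˡ _ r~v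
    component⊆unionFrom base {rs = r′ ∷ _} (there r∈rs) r~v = ∨-trueʳ (component r′ _) (component⊆unionFrom base r∈rs r~v)

    unionFrom⁻ : ∀ {base} rs {v} → unionFrom base rs v ≡ true
               → base v ≡ true ⊎ ∃ λ r → r ∈ rs × component r v ≡ true
    unionFrom⁻ []       inBase = inj₁ inBase
    unionFrom⁻ (r ∷ rs) {v} v∈ with ∨-true⁻ {component r v} v∈
    ... | inj₁ r~v = inj₂ (r , here refl , r~v)
    ... | inj₂ v∈′ with unionFrom⁻ rs v∈′
    ... | inj₁ inBase            = inj₁ inBase
    ... | inj₂ (r′ , r′∈ , r′~v) = inj₂ (r′ , there r′∈ , r′~v)

    base⊆unionFrom : ∀ {base} rs {v} → base v ≡ true → unionFrom base rs v ≡ true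
    base⊆unionFrom []       inBase = inBase
    base⊆unionFrom (r ∷ rs) inBase = ∨-trueʳ (component r _) (base⊆unionFrom rs inBase)

    free⊆unionFrom-allFin : ∀ base {v} → free v ≡ true → unionFrom base (allFin n) v ≡ true
    free⊆unionFrom-allFin base {v} fv =
      component⊆unionFrom base (∈-allFin v) (dec-true (Reach? guarded v v) (here (λ gv → not-¬ gv (not-injective fv))))

    component-shares⇒⊆ : ∀ {r r′ v w} → component r v ≡ true → component r′ v ≡ true
                       → component r w ≡ true → component r′ w ≡ true
    component-shares⇒⊆ {r} {r′} {v} {w} r~v r′~v r~w = dec-true (Reach? guarded r′ w)
      (Reach-trans (Reach-trans (component-Reach r′~v) (Reach-sym (component-Reach r~v))) (component-Reach r~w))

    ∅ : Fin n → Bool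
    ∅ _ = false

    unionFrom∅⊆free : ∀ rs {v} → unionFrom ∅ rs v ≡ true → free v ≡ true
    unionFrom∅⊆free rs v∈ with unionFrom⁻ rs v∈
    ... | inj₂ (_ , _ , r~v) = component-free r~v

    free≗unionFrom∅ : ∀ v → free v ≡ unionFrom ∅ (allFin n) v
    free≗unionFrom∅ v with free v in fv | unionFrom ∅ (allFin n) v in Uv
    ... | true  | true  = refl
    ... | false | false = refl
    ... | true  | false = ⊥-elim (not-¬ (free⊆unionFrom-allFin ∅ fv) Uv)
    ... | false | true  = ⊥-elim (not-¬ (unionFrom∅⊆free (allFin n) Uv) fv)

    meeting-component-absorbed : ∀ {r} rs {v} → component r v ≡ true → unionFrom ∅ rs v ≡ true
                               → ∀ w → component r w ∨ unionFrom ∅ rs w ≡ unionFrom ∅ rs w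
    meeting-component-absorbed {r} rs r~v v∈ w with component r w in r~w | unionFrom⁻ rs v∈
    ... | false | _                      = refl
    ... | true  | inj₂ (r′ , r′∈ , r′~v) = sym (component⊆unionFrom ∅ r′∈ (component-shares⇒⊆ r~v r′~v r~w))

  -- Boundaries and isoperimetric bounds

  module Boundaries {n : ℕ} (G : Graph n) where

    edgesBetween : (Fin n → Bool) → (Fin n → Bool) → ℕ
    edgesBetween W F = sum λ u → sum λ v → ind (W u ∧ F v ∧ adj G u v)

    edgeBoundaryᵇ : (Fin n → Bool) → ℕ
    edgeBoundaryᵇ W = edgesBetween W (not ∘ W)

    vertexBoundaryᵇ : (Fin n → Bool) → ℕ
    vertexBoundaryᵇ W = sum λ v → ind (not (W v) ∧ any (λ u → W u ∧ adj G v u) (allFin n))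

    edgesBetween-≗ˡ : ∀ {W W′} F → (∀ v → W v ≡ W′ v) → edgesBetween W F ≡ edgesBetween W′ F
    edgesBetween-≗ˡ F W≗W′ = sum-cong-≗ (λ u → sum-cong-≗ (λ v → cong (λ b → ind (b ∧ F v ∧ adj G u v)) (W≗W′ u)))

    edgesBetween-∨ˡ : ∀ {A W} F → (∀ v → A v ≡ true → W v ≡ false)
                    → edgesBetween (λ v → A v ∨ W v) F ≡ edgesBetween A F + edgesBetween W F
    edgesBetween-∨ˡ {A} {W} F disjoint = begin
      sum (λ u → sum (λ v → ind ((A u ∨ W u) ∧ F v ∧ adj G u v)))
        ≡⟨ sum-cong-≗ (λ u → sum-cong-≗ (λ v → split u (F v ∧ adj G u v))) ⟩
      sum (λ u → sum (λ v → a u v + w u v))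
        ≡⟨ sum-cong-≗ (λ u → ∑-distrib-+ (a u) (w u)) ⟩
      sum (λ u → sum (a u) + sum (w u))
        ≡⟨ ∑-distrib-+ (λ u → sum (a u)) (λ u → sum (w u)) ⟩
      edgesBetween A F + edgesBetween W F ∎
      where
      open ≡-Reasoning
      a w : Fin n → Fin n → ℕ
      a u v = ind (A u ∧ F v ∧ adj G u v)
      w u v = ind (W u ∧ F v ∧ adj G u v)
      split : ∀ u y → ind ((A u ∨ W u) ∧ y) ≡ ind (A u ∧ y) + ind (W u ∧ y)
      split u y = trans (cong ind (∧-distribʳ-∨ y (A u) (W u)))
                        (ind-∨-disjoint (A u ∧ y) (W u ∧ y) (λ Au∧y → cong (_∧ y) (disjoint u (proj₁ (∧-true⁻ Au∧y)))))

    edgeBoundary-lookup : ∀ S → edgeBoundary G S ≡ edgeBoundaryᵇ (lookup S)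
    edgeBoundary-lookup S = trans (listSum-allFin (λ u → List.sum (map (term u) (allFin n))))
                                  (sum-cong-≗ (λ u → listSum-allFin (term u)))
      where
      term : Fin n → Fin n → ℕ
      term u v = ind (lookup S u ∧ not (lookup S v) ∧ adj G u v)

    vertexBoundary-lookup : ∀ S → vertexBoundary G S ≡ vertexBoundaryᵇ (lookup S)
    vertexBoundary-lookup S = listSum-allFin (λ v → ind (not (lookup S v) ∧ any (λ u → lookup S u ∧ adj G v u) (allFin n)))

    edgeBoundaryᵇ-≗ : ∀ {W W′} → (∀ v → W v ≡ W′ v) → edgeBoundaryᵇ W ≡ edgeBoundaryᵇ W′
    edgeBoundaryᵇ-≗ W≗W′ = sum-cong-≗ (λ u → sum-cong-≗ (λ v →
      cong₂ (λ p q → ind (p ∧ not q ∧ adj G u v)) (W≗W′ u) (W≗W′ v)))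

    vertexBoundaryᵇ-≗ : ∀ {W W′} → (∀ v → W v ≡ W′ v) → vertexBoundaryᵇ W ≡ vertexBoundaryᵇ W′
    vertexBoundaryᵇ-≗ W≗W′ = sum-cong-≗ (λ v →
      cong₂ (λ p q → ind (not p ∧ q)) (W≗W′ v) (cong or (List.map-cong (λ u → cong (_∧ adj G v u) (W≗W′ u)) (allFin n))))

    edgeBoundaryᵇ≤ : ∀ W → edgeBoundaryᵇ W ≤ maxDegree G * count W
    edgeBoundaryᵇ≤ W = begin
      edgeBoundaryᵇ W                              ≤⟨ sum-mono-≤ row ⟩
      sum (λ u → maxDegree G * ind (W u))          ≡⟨ *-distribˡ-sum (maxDegree G) (ind ∘ W) ⟨
      maxDegree G * sum (ind ∘ W)                  ≡⟨ cong (maxDegree G *_) (count≡sum W) ⟨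
      maxDegree G * count W                        ∎
      where
      open ≤-Reasoning
      row : ∀ u → sum (λ v → ind (W u ∧ not (W v) ∧ adj G u v)) ≤ maxDegree G * ind (W u)
      row u with W u
      ... | false = ≤-reflexive (trans (sum-zero (λ v → ind (false ∧ not (W v) ∧ adj G u v)) (λ _ → refl))
                                       (sym (*-zeroʳ (maxDegree G))))
      ... | true  = begin
        sum (λ v → ind (not (W v) ∧ adj G u v))    ≤⟨ sum-mono-≤ (λ v → ind-mono (proj₂ ∘ ∧-true⁻ {not (W v)})) ⟩
        sum (ind ∘ adj G u)                        ≡⟨ count≡sum (adj G u) ⟨
        count (adj G u)                            ≤⟨ degree≤maxDegree G u ⟩
        maxDegree G                                ≡⟨ *-identityʳ (maxDegree G) ⟨
        maxDegree G * 1                            ∎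

    vertexBoundaryᵇ≤ : ∀ W → vertexBoundaryᵇ W ≤ count (not ∘ W)
    vertexBoundaryᵇ≤ W = ≤-trans (sum-mono-≤ (λ v → ind-mono (proj₁ ∘ ∧-true⁻ {not (W v)})))
                                 (≤-reflexive (sym (count≡sum (not ∘ W))))

  record IsoBound {n} (∂ : (Fin n → Bool) → ℕ) (a s : ℕ) : Set where
    constructor isoBound
    field
      lower : ∀ W → 1 ≤ count W → count W + count W ≤ n → a * count W ≤ s * ∂ W
  open IsoBound

  lower-allowing-empty : ∀ {n} {∂ : (Fin n → Bool) → ℕ} {a s} → IsoBound ∂ a s
             → ∀ W → count W + count W ≤ n → a * count W ≤ s * ∂ W
  lower-allowing-empty {a = a} iso W half with count W | iso .lower W
  ... | zero  | _    = ≤-trans (≤-reflexive (*-zeroʳ a)) z≤n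
  ... | suc _ | isoW = isoW (s≤s z≤n) half

  ceiling-quotient : ∀ m k → ∃ λ t → m ≤ t * suc k × t * suc k ≤ m + k
  ceiling-quotient m k = t , +-cancelʳ-≤ k m (t * suc k) m+k≤ , m/n*n≤m (m + k) (suc k)
    where
    t = (m + k) / suc k
    m+k≤ : m + k ≤ t * suc k + k
    m+k≤ = begin
      m + k                         ≡⟨ m≡m%n+[m/n]*n (m + k) (suc k) ⟩
      (m + k) % suc k + t * suc k   ≤⟨ +-monoˡ-≤ (t * suc k) (≤-pred (m%n<n (m + k) (suc k))) ⟩
      k + t * suc k                 ≡⟨ +-comm k (t * suc k) ⟩
      t * suc k + k                 ∎
      where open ≤-Reasoning

  quotient-pos : ∀ {m t} d → 1 ≤ m → m ≤ t * d → 1 ≤ t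
  quotient-pos {t = zero}  d 1≤m m≤0 = ⊥-elim (<⇒≱ 1≤m m≤0)
  quotient-pos {t = suc _} d _   _   = s≤s z≤n

  two-below : ∀ {x y t} → x < t → y < t → x + y + 2 ≤ t + t
  two-below {x} {y} {t} x<t y<t = ≤-trans (≤-reflexive shuffle) (+-mono-≤ x<t y<t)
    where
    shuffle : x + y + 2 ≡ suc x + suc y
    shuffle = solve 2 (λ x y → x :+ y :+ con 2 := (con 1 :+ x) :+ (con 1 :+ y)) refl x y

  complement-of-large : ∀ {σ w n} → σ + w ≤ n → n < w + w → σ + σ ≤ n
  complement-of-large {σ} {w} {n} σ+w≤n n<2w = <⇒≤ (+-cancelʳ-≤ n (suc (σ + σ)) n (begin
    suc (σ + σ) + n      ≡⟨ +-suc (σ + σ) n ⟨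
    σ + σ + suc n        ≤⟨ +-monoʳ-≤ (σ + σ) n<2w ⟩
    σ + σ + (w + w)      ≡⟨ solve 2 (λ σ w → σ :+ σ :+ (w :+ w) := (σ :+ w) :+ (σ :+ w)) refl σ w ⟩
    (σ + w) + (σ + w)    ≤⟨ +-mono-≤ σ+w≤n σ+w≤n ⟩
    n + n                ∎))
    where open ≤-Reasoning

  third≤ : ∀ {t T} → 1 ≤ T → t * 3 ≤ T + 2 → t ≤ T
  third≤ {t} {T} 1≤T 3t≤T+2 = *-cancelʳ-≤ t T 3 (≤-trans 3t≤T+2 (begin
    T + 2           ≤⟨ +-monoʳ-≤ T (+-mono-≤ 1≤T 1≤T) ⟩
    T + (T + T)     ≡⟨ solve 1 (λ T → T :+ (T :+ T) := T :* con 3) refl T ⟩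
    T * 3           ∎))
    where open ≤-Reasoning

  third-of-complement : ∀ {t σ w} → t * 3 ≤ σ + w + 2 → w + 2 ≤ t + t → t ≤ σ
  third-of-complement {t} {σ} {w} 3t≤ w+2≤2t = +-cancelʳ-≤ (t + t) t σ (begin
    t + (t + t)     ≡⟨ solve 1 (λ t → t :+ (t :+ t) := t :* con 3) refl t ⟩
    t * 3           ≤⟨ 3t≤ ⟩
    σ + w + 2       ≡⟨ +-assoc σ w 2 ⟩
    σ + (w + 2)     ≤⟨ +-monoʳ-≤ σ w+2≤2t ⟩
    σ + (t + t)     ∎)
    where open ≤-Reasoning

  quarter-half : ∀ {w t n} → w + 2 ≤ t + t → t * 4 ≤ n + 3 → w + w ≤ n
  quarter-half {w} {t} {n} w+2≤2t 4t≤n+3 = <⇒≤ (+-cancelʳ-≤ 3 (suc (w + w)) n (begin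
    suc (w + w) + 3          ≡⟨ solve 1 (λ w → con 1 :+ (w :+ w) :+ con 3 := (w :+ con 2) :+ (w :+ con 2)) refl w ⟩
    (w + 2) + (w + 2)        ≤⟨ +-mono-≤ w+2≤2t w+2≤2t ⟩
    (t + t) + (t + t)        ≡⟨ solve 1 (λ t → (t :+ t) :+ (t :+ t) := t :* con 4) refl t ⟩
    t * 4                    ≤⟨ 4t≤n+3 ⟩
    n + 3                    ∎))
    where open ≤-Reasoning

  quarter-threshold : ∀ {n X f t} → n ≤ X + f → f + f < n → t * 4 ≤ n + 3 → t ≤ X
  quarter-threshold {n} {X} {f} {t} n≤X+f 2f<n 4t≤n+3 with t ≤? X
  ... | yes t≤X = t≤X
  ... | no  t≰X = ⊥-elim (<⇒≱ f<X (≤-trans (m≤n+m X (X + X)) 3X<f))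
    where
    open ≤-Reasoning
    f<X : f < X
    f<X = +-cancelʳ-≤ f (suc f) X (≤-trans 2f<n n≤X+f)
    3X<f : X + X + X ≤ f
    3X<f = +-cancelˡ-≤ X (X + X + X) f (<⇒≤ (+-cancelʳ-≤ 3 (suc (X + (X + X + X))) (X + f) (begin
      suc (X + (X + X + X)) + 3   ≡⟨ solve 1 (λ X → con 1 :+ (X :+ (X :+ X :+ X)) :+ con 3 := (con 1 :+ X) :* con 4) refl X ⟩
      suc X * 4                   ≤⟨ *-monoˡ-≤ 4 (≰⇒> t≰X) ⟩
      t * 4                       ≤⟨ 4t≤n+3 ⟩
      n + 3                       ≤⟨ +-monoˡ-≤ 3 n≤X+f ⟩
      X + f + 3                   ∎)))

  ∣∣≡count-lookup : ∀ {n} (S : Subset n) → ∣ S ∣ ≡ count (lookup S)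
  ∣∣≡count-lookup S = trans (size S) (sym (count≡sum (lookup S)))
    where
    size : ∀ {m} (S : Subset m) → ∣ S ∣ ≡ sum (ind ∘ lookup S)
    size []          = refl
    size (true ∷ S)  = cong suc (size S)
    size (false ∷ S) = size S

  IsoBound-tabulate : ∀ {n} {f : Subset n → ℕ} {∂ : (Fin n → Bool) → ℕ} {a s}
                    → (∀ S → f S ≡ ∂ (lookup S)) → (∀ {W W′} → (∀ v → W v ≡ W′ v) → ∂ W ≡ ∂ W′)
                    → (∀ S → 0 < ∣ S ∣ → 2 * ∣ S ∣ ≤ n → a * ∣ S ∣ ≤ s * f S) → IsoBound ∂ a s
  IsoBound-tabulate {n} {f} {∂} {a} {s} f≡∂ ∂-≗ bound = isoBound λ W 1≤W half →
    subst₂ (λ x y → a * x ≤ s * y) (|S|≡|W| W) (trans (f≡∂ (Vec.tabulate W)) (∂-≗ (lookup∘tabulate W)))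
      (bound (Vec.tabulate W) (≤-trans 1≤W (≤-reflexive (sym (|S|≡|W| W))))
             (≤-trans (≤-reflexive (trans (cong (2 *_) (|S|≡|W| W)) (cong (count W +_) (+-identityʳ (count W))))) half))
    where
    |S|≡|W| : ∀ W → ∣ Vec.tabulate W ∣ ≡ count W
    |S|≡|W| W = trans (∣∣≡count-lookup (Vec.tabulate W)) (count-≗ (lookup∘tabulate W))

  count-prefix : ∀ {n} h → h ≤ n → count {n} (λ v → toℕ v <ᵇ h) ≡ h
  count-prefix h h≤n = trans (count≡sum _) (prefix h≤n)
    where
    prefix : ∀ {n h} → h ≤ n → sum {n} (λ v → ind (toℕ v <ᵇ h)) ≡ h
    prefix {zero}          z≤n       = refl
    prefix {suc n} {zero}  z≤n       = sum-zero {suc n} (λ v → ind (toℕ v <ᵇ 0)) (λ _ → refl)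
    prefix {suc n} {suc h} (s≤s h≤n) = cong suc (prefix h≤n)

  module _ {n : ℕ} (G : Graph n) where
    open Boundaries G

    vertexIso≤2 : ∀ {a s} → IsoBound vertexBoundaryᵇ a s → 2 ≤ n → a ≤ 2 * s
    vertexIso≤2 {a} {s} iso 2≤n = *-cancelʳ-≤ a (2 * s) h {{>-nonZero 1≤h}} (begin
      a * h                        ≡⟨ cong (a *_) |W| ⟨
      a * count W                  ≤⟨ iso .lower W (≤-trans 1≤h (≤-reflexive (sym |W|)))
                                                     (≤-trans (≤-reflexive (cong₂ _+_ |W| |W|)) h+h≤n) ⟩
      s * vertexBoundaryᵇ W        ≤⟨ *-monoʳ-≤ s (≤-trans (vertexBoundaryᵇ≤ W) outside≤) ⟩
      s * (h + h)                  ≡⟨ solve 2 (λ s h → s :* (h :+ h) := con 2 :* s :* h) refl s h ⟩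
      2 * s * h                    ∎)
      where
      open ≤-Reasoning
      h = n / 2
      h+h≤n : h + h ≤ n
      h+h≤n = ≤-trans (≤-reflexive (solve 1 (λ h → h :+ h := h :* con 2) refl h)) (m/n*n≤m n 2)
      n≤h+h+1 : n ≤ h + h + 1
      n≤h+h+1 = begin
        n                     ≡⟨ m≡m%n+[m/n]*n n 2 ⟩
        n % 2 + h * 2         ≤⟨ +-monoˡ-≤ (h * 2) (≤-pred (m%n<n n 2)) ⟩
        1 + h * 2             ≡⟨ solve 1 (λ h → con 1 :+ h :* con 2 := h :+ h :+ con 1) refl h ⟩
        h + h + 1             ∎
      1≤h : 1 ≤ h
      1≤h = quotient-pos 2 (s≤s z≤n) (+-cancelʳ-≤ 1 1 (h * 2) (≤-trans 2≤n (≤-trans n≤h+h+1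
              (≤-reflexive (solve 1 (λ h → h :+ h :+ con 1 := h :* con 2 :+ con 1) refl h)))))
      W : Fin n → Bool
      W v = toℕ v <ᵇ h
      |W| : count W ≡ h
      |W| = count-prefix h (≤-trans (m≤m+n h h) h+h≤n)
      outside≤ : count (not ∘ W) ≤ h + h
      outside≤ = +-cancelˡ-≤ h (count (not ∘ W)) (h + h) (begin
        h + count (not ∘ W)         ≡⟨ cong (_+ count (not ∘ W)) |W| ⟨
        count W + count (not ∘ W)   ≡⟨ count-complement W ⟩
        n                           ≤⟨ n≤h+h+1 ⟩
        h + h + 1                   ≡⟨ +-assoc h h 1 ⟩
        h + (h + 1)                 ≤⟨ +-monoʳ-≤ h (+-monoʳ-≤ h 1≤h) ⟩
        h + (h + h)                 ∎)

  -- The three bounds for a good placement, and for the cop number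

  module EdgeBounds {n : ℕ} (G : Graph n) {k : ℕ} (C : Fin k → Fin n) where
    open Configuration G C
    open Neighbourhood G C
    open Boundaries G
    open Saturated

    saturated-edgeBoundary : ∀ {W} → Saturated W → (∀ v → W v ≡ true → free v ≡ true)
                           → edgeBoundaryᵇ W ≡ edgesBetween W frontier
    saturated-edgeBoundary {W} sat W⊆free = sum-cong-≗ (λ u → sum-cong-≗ (λ v → cong ind (term u v)))
      where
      term : ∀ u v → W u ∧ not (W v) ∧ adj G u v ≡ W u ∧ frontier v ∧ adj G u v
      term u v with W u in Wu | W v in Wv | adj G u v in uv
      ... | false | _     | _     = refl
      ... | true  | _     | false = trans (∧-zeroʳ _) (sym (∧-zeroʳ (frontier v)))
      ... | true  | false | true  = sym (cong (_∧ true) (sat .exits-to-frontier Wu uv Wv))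
      ... | true  | true  | true  = sym (cong (λ b → (b ∧ not (occupied v)) ∧ true) (not-injective (W⊆free v Wv)))

    edges-free-frontier : edgesBetween free frontier ≤ (maxDegree G ∸ 1) * count frontier
    edges-free-frontier = begin
      edgesBetween free frontier
        ≡⟨ ∑-comm (λ u v → ind (free u ∧ frontier v ∧ adj G u v)) ⟩
      sum (λ v → sum (λ u → ind (free u ∧ frontier v ∧ adj G u v)))
        ≤⟨ sum-mono-≤ column ⟩
      sum (λ v → (maxDegree G ∸ 1) * ind (frontier v))
        ≡⟨ *-distribˡ-sum (maxDegree G ∸ 1) (ind ∘ frontier) ⟨
      (maxDegree G ∸ 1) * sum (ind ∘ frontier)
        ≡⟨ cong ((maxDegree G ∸ 1) *_) (count≡sum frontier) ⟨
      (maxDegree G ∸ 1) * count frontier ∎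
      where
      open ≤-Reasoning
      column : ∀ v → sum (λ u → ind (free u ∧ frontier v ∧ adj G u v)) ≤ (maxDegree G ∸ 1) * ind (frontier v)
      column v with frontier v in fv
      ... | false = ≤-reflexive (trans (sum-zero _ (λ u → cong ind (∧-zeroʳ (free u)))) (sym (*-zeroʳ (maxDegree G ∸ 1))))
      ... | true with guarded⁻ (proj₁ (∧-true⁻ {guarded v} fv)) (not-injective (proj₂ (∧-true⁻ {guarded v} fv)))
      ... | i , Ci~v = ≤-trans (∸-monoˡ-≤ 1 (≤-trans fewer (≤-trans (≤-reflexive (sym (count≡sum (adj G v))))
                                                                     (degree≤maxDegree G v))))
                               (≤-reflexive (sym (*-identityʳ _)))
        where
        fewer : sum (λ u → ind (free u ∧ adj G u v)) < sum (λ u → ind (adj G v u))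
        fewer = sum-mono-< (λ u → ind-mono (λ fu∧uv → trans (Graph.sym G v u) (proj₂ (∧-true⁻ {free u} fu∧uv))))
                           (C i) copNotFree
          where
          copNotFree : ind (free (C i) ∧ adj G (C i) v) < ind (adj G v (C i))
          copNotFree rewrite Occupied⇒guarded (i , refl) | Graph.sym G v (C i) | Ci~v = s≤s z≤n

    module _ {a s : ℕ} (iso : IsoBound edgeBoundaryᵇ a s) (small : AllComponentsSmall) where

      unions-edge-bound : ∀ rs → a * count (unionFrom ∅ rs) ≤ s * edgesBetween (unionFrom ∅ rs) frontier
      unions-edge-bound [] = ≤-trans (≤-reflexive (trans (cong (a *_) count-∅) (*-zeroʳ a))) z≤n
      unions-edge-bound (r ∷ rs) with any? (λ v → component r v ∧ unionFrom ∅ rs v ≟ᵇ true)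
      ... | yes (v , shared) = subst₂ (λ x y → a * x ≤ s * y)
                                 (sym (count-≗ absorbed)) (sym (edgesBetween-≗ˡ frontier absorbed)) (unions-edge-bound rs)
        where
        absorbed = meeting-component-absorbed rs (proj₁ (∧-true⁻ {component r v} shared)) (proj₂ (∧-true⁻ {component r v} shared))
      ... | no ¬shared = begin
        a * count (λ v → A v ∨ W v)                                          ≡⟨ cong (a *_) (count-∨-disjoint A W disjoint) ⟩
        a * (count A + count W)                                              ≡⟨ *-distribˡ-+ a (count A) (count W) ⟩
        a * count A + a * count W                                            ≤⟨ +-mono-≤ componentBound (unions-edge-bound rs) ⟩
        s * edgesBetween A frontier + s * edgesBetween W frontier            ≡⟨ *-distribˡ-+ s _ _ ⟨
        s * (edgesBetween A frontier + edgesBetween W frontier)              ≡⟨ cong (s *_) (edgesBetween-∨ˡ frontier disjoint) ⟨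
        s * edgesBetween (λ v → A v ∨ W v) frontier                          ∎
        where
        open ≤-Reasoning
        A W : Fin n → Bool
        A = component r
        W = unionFrom ∅ rs
        disjoint : ∀ v → A v ≡ true → W v ≡ false
        disjoint v Av with W v in Wv
        ... | false = refl
        ... | true  = ⊥-elim (¬shared (v , cong₂ _∧_ Av Wv))
        componentBound : a * count A ≤ s * edgesBetween A frontier
        componentBound = ≤-trans (lower-allowing-empty iso A (small r))
                                 (≤-reflexive (cong (s *_) (saturated-edgeBoundary (component-saturated r) (λ _ → component-free))))

      free-edge-bound : a * count free ≤ s * ((maxDegree G ∸ 1) * count frontier)
      free-edge-bound = begin
        a * count free                                      ≡⟨ cong (a *_) (count-≗ free≗unionFrom∅) ⟩
        a * count U                                         ≤⟨ unions-edge-bound (allFin n) ⟩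
        s * edgesBetween U frontier                         ≡⟨ cong (s *_) (edgesBetween-≗ˡ frontier free≗unionFrom∅) ⟨
        s * edgesBetween free frontier                      ≤⟨ *-monoʳ-≤ s edges-free-frontier ⟩
        s * ((maxDegree G ∸ 1) * count frontier)            ∎
        where
        open ≤-Reasoning
        U = unionFrom ∅ (allFin n)

  module VertexBounds {n : ℕ} (G : Graph n) {k : ℕ} (C : Fin k → Fin n) where
    open Configuration G C
    open Neighbourhood G C
    open Boundaries G
    open Saturated

    saturated-vertexBoundary : ∀ {W} → Saturated W → vertexBoundaryᵇ W ≤ count frontier
    saturated-vertexBoundary {W} sat = ≤-trans (sum-mono-≤ (λ v → ind-mono (exit v))) (≤-reflexive (sym (count≡sum frontier)))
      where
      exit : ∀ v → not (W v) ∧ any (λ u → W u ∧ adj G v u) (allFin n) ≡ true → frontier v ≡ true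
      exit v out with ∧-true⁻ {not (W v)} out
      ... | ¬Wv , found with any-true⁻ (λ u → W u ∧ adj G v u) (allFin n) found
      ... | u , Wu∧vu = sat .exits-to-frontier (proj₁ (∧-true⁻ {W u} Wu∧vu))
                                              (trans (Graph.sym G u v) (proj₂ (∧-true⁻ {W u} Wu∧vu))) (not-injective ¬Wv)

    Admissible : (Fin n → Bool) → Set
    Admissible S = Saturated S × 1 ≤ count S × count S + count S ≤ n

    admissible-bound : ∀ {a s} → IsoBound vertexBoundaryᵇ a s → ∀ {S} → Admissible S → a * count S ≤ s * count frontier
    admissible-bound {s = s} iso {S} (sat , 1≤S , half) = ≤-trans (iso .lower S 1≤S half) (*-monoʳ-≤ s (saturated-vertexBoundary sat))

    threshold-crossing : ∀ base rs {t} → count base < t → t ≤ count (unionFrom base rs)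
                       → ∃₂ λ r rs′ → count (unionFrom base rs′) < t × t ≤ count (unionFrom base (r ∷ rs′))
    threshold-crossing base []       below above = ⊥-elim (<⇒≱ below above)
    threshold-crossing base (r ∷ rs) {t} below above with t ≤? count (unionFrom base rs)
    ... | yes above′ = threshold-crossing base rs below above′
    ... | no  below′ = r , rs , ≰⇒> below′ , above

    complement-admissible : ∀ rs {t} → 1 ≤ t → t * 3 ≤ count free + 2 → count (unionFrom ∅ rs) + 2 ≤ t + t
                          → n < count (unionFrom ∅ rs) + count (unionFrom ∅ rs)
                          → ∃ λ S → Admissible S × t ≤ count S
    complement-admissible rs {t} 1≤t 3t≤T+2 W+2≤2t big =
      S , (complement-saturated (unionFrom-saturated ∅-saturated rs) , ≤-trans 1≤t t≤S
          , complement-of-large {count S} {count W} (≤-trans (≤-reflexive S+W≡T) (count≤n free)) big) , t≤S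
      where
      W S : Fin n → Bool
      W = unionFrom ∅ rs
      S v = free v ∧ not (W v)
      partition : ∀ v → S v ∨ W v ≡ free v
      partition v with W v in Wv | free v in fv
      ... | true  | true  = refl
      ... | true  | false = ⊥-elim (not-¬ (unionFrom∅⊆free rs Wv) fv)
      ... | false | true  = refl
      ... | false | false = refl
      S+W≡T : count S + count W ≡ count free
      S+W≡T = trans (sym (count-∨-disjoint S W (λ v Sv → not-injective (proj₂ (∧-true⁻ {free v} Sv))))) (count-≗ partition)
      t≤S : t ≤ count S
      t≤S = third-of-complement (≤-trans 3t≤T+2 (≤-reflexive (cong (_+ 2) (sym S+W≡T)))) W+2≤2t

    module _ (small : AllComponentsSmall) where

      balanced-union : ∀ base rs {t} → 1 ≤ t → count base < t → t ≤ count (unionFrom base rs)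
                     → (∃ λ S → Admissible S × t ≤ count S)
                     ⊎ (∃ λ rs′ → t ≤ count (unionFrom base rs′) × count (unionFrom base rs′) + 2 ≤ t + t)
      balanced-union base rs {t} 1≤t below above with threshold-crossing base rs below above
      ... | r , rs′ , W<t , t≤W′ with t ≤? count (component r)
      ... | yes t≤A = inj₁ (component r , (component-saturated r , ≤-trans 1≤t t≤A , small r) , t≤A)
      ... | no  t≰A = inj₂ (r ∷ rs′ , t≤W′ ,
        ≤-trans (+-monoˡ-≤ 2 (count-∨ (component r) (unionFrom base rs′))) (two-below (≰⇒> t≰A) W<t))

      third-admissible : 1 ≤ count free → ∃ λ S → Admissible S × count free ≤ count S * 3
      third-admissible 1≤T = scale ([ (λ found → found) , medium-union ]′
                                     (balanced-union ∅ (allFin n) 1≤t (≤-trans (s≤s (≤-reflexive count-∅)) 1≤t) t≤U))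
        where
        t = proj₁ (ceiling-quotient (count free) 2)
        T≤3t : count free ≤ t * 3
        T≤3t = proj₁ (proj₂ (ceiling-quotient (count free) 2))
        3t≤T+2 : t * 3 ≤ count free + 2
        3t≤T+2 = proj₂ (proj₂ (ceiling-quotient (count free) 2))
        1≤t : 1 ≤ t
        1≤t = quotient-pos 3 1≤T T≤3t
        t≤U : t ≤ count (unionFrom ∅ (allFin n))
        t≤U = ≤-trans (third≤ 1≤T 3t≤T+2) (≤-reflexive (count-≗ free≗unionFrom∅))

        union-or-complement : ∀ rs′ → t ≤ count (unionFrom ∅ rs′) → count (unionFrom ∅ rs′) + 2 ≤ t + t
                            → Dec (count (unionFrom ∅ rs′) + count (unionFrom ∅ rs′) ≤ n)
                            → ∃ λ S → Admissible S × t ≤ count S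
        union-or-complement rs′ t≤W _ (yes half) =
          unionFrom ∅ rs′ , (unionFrom-saturated ∅-saturated rs′ , ≤-trans 1≤t t≤W , half) , t≤W
        union-or-complement rs′ _ W+2≤2t (no big) = complement-admissible rs′ 1≤t 3t≤T+2 W+2≤2t (≰⇒> big)

        medium-union : (∃ λ rs′ → t ≤ count (unionFrom ∅ rs′) × count (unionFrom ∅ rs′) + 2 ≤ t + t)
                     → ∃ λ S → Admissible S × t ≤ count S
        medium-union (rs′ , t≤W , W+2≤2t) = union-or-complement rs′ t≤W W+2≤2t (_ ≤? n)

        scale : (∃ λ S → Admissible S × t ≤ count S) → ∃ λ S → Admissible S × count free ≤ count S * 3
        scale (S , admissible , t≤S) = S , admissible , ≤-trans T≤3t (*-monoˡ-≤ 3 t≤S)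

      quarter-admissible : 1 ≤ n → count occupied + count occupied ≤ n → count frontier + count frontier < n
                         → ∃ λ S → Admissible S × n ≤ count S * 4
      quarter-admissible 1≤n occupiedHalf frontierSmall = scale (choose (t ≤? count occupied))
        where
        t = proj₁ (ceiling-quotient n 3)
        n≤4t : n ≤ t * 4
        n≤4t = proj₁ (proj₂ (ceiling-quotient n 3))
        4t≤n+3 : t * 4 ≤ n + 3
        4t≤n+3 = proj₂ (proj₂ (ceiling-quotient n 3))
        1≤t : 1 ≤ t
        1≤t = quotient-pos 4 1≤n n≤4t

        occupied∨free≤U : count occupied + count free ≤ count (unionFrom occupied (allFin n))
        occupied∨free≤U = ≤-trans (≤-reflexive (sym (count-∨-disjoint occupied free occupied⇒¬free)))
                                  (count-mono covered)
          where
          occupied⇒¬free : ∀ v → occupied v ≡ true → free v ≡ false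
          occupied⇒¬free v occ = cong not (Occupied⇒guarded (occupied⁻ occ))
          covered : ∀ v → occupied v ∨ free v ≡ true → unionFrom occupied (allFin n) v ≡ true
          covered v occ∨free with ∨-true⁻ {occupied v} occ∨free
          ... | inj₁ occ = base⊆unionFrom (allFin n) occ
          ... | inj₂ fv  = free⊆unionFrom-allFin occupied fv

        t≤U : t ≤ count (unionFrom occupied (allFin n))
        t≤U = ≤-trans (quarter-threshold n≤X+f frontierSmall 4t≤n+3) occupied∨free≤U
          where
          n≤X+f : n ≤ count occupied + count free + count frontier
          n≤X+f = ≤-trans n≤occupied+frontier+free
                          (≤-reflexive (solve 3 (λ o f y → o :+ f :+ y := o :+ y :+ f) refl (count occupied) (count frontier) (count free)))

        choose : Dec (t ≤ count occupied) → ∃ λ S → Admissible S × t ≤ count S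
        choose (yes t≤occ) = occupied , (occupied-saturated , ≤-trans 1≤t t≤occ , occupiedHalf) , t≤occ
        choose (no  t≰occ) = [ (λ found → found) , medium-union ]′
                               (balanced-union occupied (allFin n) 1≤t (≰⇒> t≰occ) t≤U)
          where
          medium-union : (∃ λ rs′ → t ≤ count (unionFrom occupied rs′) × count (unionFrom occupied rs′) + 2 ≤ t + t)
                       → ∃ λ S → Admissible S × t ≤ count S
          medium-union (rs′ , t≤W , W+2≤2t) =
            unionFrom occupied rs′ , (unionFrom-saturated occupied-saturated rs′ , ≤-trans 1≤t t≤W , quarter-half {count (unionFrom occupied rs′)} {t} W+2≤2t 4t≤n+3) , t≤W

        scale : (∃ λ S → Admissible S × t ≤ count S) → ∃ λ S → Admissible S × n ≤ count S * 4
        scale (S , admissible , t≤S) = S , admissible , ≤-trans n≤4t (*-monoˡ-≤ 4 t≤S)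

      module _ {a s : ℕ} (iso : IsoBound vertexBoundaryᵇ a s) where

        free-vertex-bound : a * count free ≤ 3 * (s * count frontier)
        free-vertex-bound = bound (1 ≤? count free)
          where
          open ≤-Reasoning
          bound : Dec (1 ≤ count free) → a * count free ≤ 3 * (s * count frontier)
          bound (no  T≱1) = ≤-trans (≤-reflexive (trans (cong (a *_) (n<1⇒n≡0 (≰⇒> T≱1))) (*-zeroʳ a))) z≤n
          bound (yes 1≤T) = let (S , admissible , T≤3S) = third-admissible 1≤T in begin
            a * count free              ≤⟨ *-monoʳ-≤ a T≤3S ⟩
            a * (count S * 3)           ≡⟨ solve 2 (λ a S → a :* (S :* con 3) := con 3 :* (a :* S)) refl a (count S) ⟩
            3 * (a * count S)           ≤⟨ *-monoʳ-≤ 3 (admissible-bound iso admissible) ⟩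
            3 * (s * count frontier)    ∎

        n-vertex-bound : 1 ≤ n → count occupied + count occupied ≤ n → count frontier + count frontier < n
                       → a * n ≤ 4 * (s * count frontier)
        n-vertex-bound 1≤n occupiedHalf frontierSmall =
          let (S , admissible , n≤4S) = quarter-admissible 1≤n occupiedHalf frontierSmall in begin
            a * n                       ≤⟨ *-monoʳ-≤ a n≤4S ⟩
            a * (count S * 4)           ≡⟨ solve 2 (λ a S → a :* (S :* con 4) := con 4 :* (a :* S)) refl a (count S) ⟩
            4 * (a * count S)           ≤⟨ *-monoʳ-≤ 4 (admissible-bound iso admissible) ⟩
            4 * (s * count frontier)    ∎
          where open ≤-Reasoning

  edge-arithmetic : ∀ {a s c Δ n o f y} → n ≤ o + f + y → o ≤ c → f ≤ c * Δ → a * y ≤ s * ((Δ ∸ 1) * f)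
                  → a * n ≤ s * (c * (Δ * (Δ ∸ 1))) + a * (c * (Δ + 1))
  edge-arithmetic {a} {s} {c} {Δ} {n} {o} {f} {y} n≤ o≤c f≤cΔ y-bound = begin
    a * n                                        ≤⟨ *-monoʳ-≤ a n≤ ⟩
    a * (o + f + y)                              ≡⟨ solve 4 (λ a o f y → a :* (o :+ f :+ y) := a :* o :+ a :* f :+ a :* y) refl a o f y ⟩
    a * o + a * f + a * y                        ≤⟨ +-mono-≤ (+-mono-≤ (*-monoʳ-≤ a o≤c) (*-monoʳ-≤ a f≤cΔ))
                                                             (≤-trans y-bound (*-monoʳ-≤ s (*-monoʳ-≤ (Δ ∸ 1) f≤cΔ))) ⟩
    a * c + a * (c * Δ) + s * ((Δ ∸ 1) * (c * Δ)) ≡⟨ solve 5 (λ a s c Δ e → a :* c :+ a :* (c :* Δ) :+ s :* (e :* (c :* Δ))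
                                                                := s :* (c :* (Δ :* e)) :+ a :* (c :* (Δ :+ con 1))) refl a s c Δ (Δ ∸ 1) ⟩
    s * (c * (Δ * (Δ ∸ 1))) + a * (c * (Δ + 1))  ∎
    where open ≤-Reasoning

  vertex-arithmetic : ∀ {a s c Δ n o f y} → n ≤ o + f + y → o ≤ c → f ≤ c * Δ → a * y ≤ 3 * (s * f)
                    → a * n ≤ 3 * (s * (c * Δ)) + a * (c * (Δ + 1))
  vertex-arithmetic {a} {s} {c} {Δ} {n} {o} {f} {y} n≤ o≤c f≤cΔ y-bound = begin
    a * n                                      ≤⟨ *-monoʳ-≤ a n≤ ⟩
    a * (o + f + y)                            ≡⟨ solve 4 (λ a o f y → a :* (o :+ f :+ y) := a :* o :+ a :* f :+ a :* y) refl a o f y ⟩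
    a * o + a * f + a * y                      ≤⟨ +-mono-≤ (+-mono-≤ (*-monoʳ-≤ a o≤c) (*-monoʳ-≤ a f≤cΔ))
                                                           (≤-trans y-bound (*-monoʳ-≤ 3 (*-monoʳ-≤ s f≤cΔ))) ⟩
    a * c + a * (c * Δ) + 3 * (s * (c * Δ))    ≡⟨ solve 4 (λ a s c Δ → a :* c :+ a :* (c :* Δ) :+ con 3 :* (s :* (c :* Δ))
                                                                := con 3 :* (s :* (c :* Δ)) :+ a :* (c :* (Δ :+ con 1))) refl a s c Δ ⟩
    3 * (s * (c * Δ)) + a * (c * (Δ + 1))      ∎
    where open ≤-Reasoning

  *-suc-mono : ∀ {a Δ σ} → a ≤ Δ * σ → a * (Δ + 1) ≤ (Δ * Δ + Δ) * σ
  *-suc-mono {a} {Δ} {σ} a≤Δσ = ≤-trans (*-monoˡ-≤ (Δ + 1) a≤Δσ)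
    (≤-reflexive (solve 2 (λ Δ σ → Δ :* σ :* (Δ :+ con 1) := (Δ :* Δ :+ Δ) :* σ) refl Δ σ))

  half-exceeded : ∀ {a s n m} → ¬ (a * n ≤ 4 * (s * m)) → a ≤ 2 * s → m + m < n
  half-exceeded {a} {s} {n} {m} ¬bound a≤2s with m + m <? n
  ... | yes m+m<n = m+m<n
  ... | no  n≤m+m = ⊥-elim (¬bound (begin
    a * n              ≤⟨ *-monoʳ-≤ a (≮⇒≥ n≤m+m) ⟩
    a * (m + m)        ≤⟨ *-monoˡ-≤ (m + m) a≤2s ⟩
    2 * s * (m + m)    ≡⟨ solve 2 (λ s m → con 2 :* s :* (m :+ m) := con 4 :* (s :* m)) refl s m ⟩
    4 * (s * m)        ∎))
    where open ≤-Reasoning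

  module CopBounds {n : ℕ} (G : Graph n) {c : ℕ} (win : CopsWin G c) where
    open Boundaries G

    private
      Δ : ℕ
      Δ = maxDegree G

    edge-bound : ∀ {a s} → IsoBound edgeBoundaryᵇ a s → a * n ≤ s * (c * (Δ * (Δ ∸ 1))) + a * (c * (Δ + 1))
    edge-bound {a} {s} iso = bound-from-small-configuration G (_ ≤? _) win λ C small →
      edge-arithmetic {a} {s} (Neighbourhood.n≤occupied+frontier+free G C) (Neighbourhood.count-occupied≤ G C)
                      (Neighbourhood.count-frontier≤ G C) (EdgeBounds.free-edge-bound G C {a} {s} iso small)

    vertex-bound : ∀ {a s} → IsoBound vertexBoundaryᵇ a s → a * n ≤ 3 * (s * (c * Δ)) + a * (c * (Δ + 1))
    vertex-bound {a} {s} iso = bound-from-small-configuration G (_ ≤? _) win λ C small →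
      vertex-arithmetic {a} {s} (Neighbourhood.n≤occupied+frontier+free G C) (Neighbourhood.count-occupied≤ G C)
                        (Neighbourhood.count-frontier≤ G C) (VertexBounds.free-vertex-bound G C small {a} {s} iso)

    vertex-bound-quarter : ∀ {a s} → IsoBound vertexBoundaryᵇ a s → Connected G → 2 ≤ n
                         → a * n ≤ 4 * (s * (c * Δ))
    vertex-bound-quarter {a} {s} iso conn 2≤n =
      bound-from-small-configuration G (_ ≤? _) win λ C small → decide C small (_ ≤? _)
      where
      a≤2s = vertexIso≤2 G iso 2≤n
      1≤Δ = connected⇒1≤maxDegree G conn 2≤n
      1≤n = ≤-trans (s≤s z≤n) 2≤n
      decide : ∀ C → Configuration.AllComponentsSmall G C → Dec (a * n ≤ 4 * (s * (c * Δ))) → a * n ≤ 4 * (s * (c * Δ))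
      decide C small (yes bound) = bound
      decide C small (no ¬bound) = ≤-trans (VertexBounds.n-vertex-bound G C small {a} {s} iso 1≤n occupiedHalf frontierSmall)
                                           (*-monoʳ-≤ 4 (*-monoʳ-≤ s frontier≤))
        where
        open Configuration G C using (occupied; frontier)
        frontier≤ = Neighbourhood.count-frontier≤ G C
        large = half-exceeded {a} {s} {n} {c * Δ} ¬bound a≤2s
        occupied≤ : count occupied ≤ c * Δ
        occupied≤ = ≤-trans (Neighbourhood.count-occupied≤ G C) (m≤m*n c Δ {{>-nonZero 1≤Δ}})
        occupiedHalf : count occupied + count occupied ≤ n
        occupiedHalf = <⇒≤ (≤-trans (s≤s (+-mono-≤ occupied≤ occupied≤)) large)
        frontierSmall : count frontier + count frontier < n
        frontierSmall = ≤-trans (s≤s (+-mono-≤ frontier≤ frontier≤)) large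

module RationalBounds where

  open import Data.Nat using (ℕ; zero; suc; _≤_; z≤n; s≤s)
  import Data.Nat as ℕ
  import Data.Nat.Properties as ℕ
  open import Data.Integer using (+_)
  import Data.Integer as ℤ
  import Data.Integer.Properties as ℤ
  open import Data.Rational as ℚ using (ℚ; toℚᵘ)
  import Data.Rational.Properties as ℚ
  import Data.Rational.Unnormalised as ℚᵘ
  import Data.Rational.Unnormalised.Properties as ℚᵘ
  open import Data.Rational.Solver using (module +-*-Solver)
  open import Data.Fin.Subset using (Subset; ∣_∣)
  open import Data.Vec using (lookup)
  open import Data.Product using (_,_)
  open import Relation.Binary.PropositionalEquality
  open NaturalBounds using (count; IsoBound; IsoBound-tabulate; ∣∣≡count-lookup; *-suc-mono; module Boundaries)

  module ℚ-Solver = +-*-Solver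

  private
    _/ᵘ_ : ℕ → ℕ → ℚᵘ.ℚᵘ
    a /ᵘ d = ℚᵘ.mkℚᵘ (+ a) d

    toℚᵘ-frac : ∀ a d → toℚᵘ (frac a (suc d)) ℚᵘ.≃ a /ᵘ d
    toℚᵘ-frac a d = ℚ.toℚᵘ-fromℚᵘ (a /ᵘ d)

    /ᵘ-≃ : ∀ {a d b e} → a ℕ.* suc e ≡ b ℕ.* suc d → a /ᵘ d ℚᵘ.≃ b /ᵘ e
    /ᵘ-≃ {a} {d} {b} {e} eq = ℚᵘ.*≡* (trans (sym (ℤ.pos-* a (suc e))) (trans (cong +_ eq) (ℤ.pos-* b (suc d))))

    /ᵘ-≤⁻ : ∀ {a d b e} → a /ᵘ d ℚᵘ.≤ b /ᵘ e → a ℕ.* suc e ≤ b ℕ.* suc d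
    /ᵘ-≤⁻ {a} {d} {b} {e} (ℚᵘ.*≤* le) = ℤ.drop‿+≤+ (subst₂ ℤ._≤_ (sym (ℤ.pos-* a (suc e))) (sym (ℤ.pos-* b (suc d))) le)

    /ᵘ-≤⁺ : ∀ {a d b e} → a ℕ.* suc e ≤ b ℕ.* suc d → a /ᵘ d ℚᵘ.≤ b /ᵘ e
    /ᵘ-≤⁺ {a} {d} {b} {e} le = ℚᵘ.*≤* (subst₂ ℤ._≤_ (ℤ.pos-* a (suc e)) (ℤ.pos-* b (suc d)) (ℤ.+≤+ le))

    +ᵘ-/ᵘ : ∀ a d b e → a /ᵘ d ℚᵘ.+ b /ᵘ e ≡ (a ℕ.* suc e ℕ.+ b ℕ.* suc d) /ᵘ (e ℕ.+ d ℕ.* suc e)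
    +ᵘ-/ᵘ a d b e = cong (λ z → ℚᵘ.mkℚᵘ z (e ℕ.+ d ℕ.* suc e))
      (trans (cong₂ ℤ._+_ (sym (ℤ.pos-* a (suc e))) (sym (ℤ.pos-* b (suc d)))) (sym (ℤ.pos-+ (a ℕ.* suc e) (b ℕ.* suc d))))

    *ᵘ-/ᵘ : ∀ a d b e → a /ᵘ d ℚᵘ.* b /ᵘ e ≡ (a ℕ.* b) /ᵘ (e ℕ.+ d ℕ.* suc e)
    *ᵘ-/ᵘ a d b e = cong (λ z → ℚᵘ.mkℚᵘ z (e ℕ.+ d ℕ.* suc e)) (sym (ℤ.pos-* a b))

    ℚ-≡ : ∀ {p q} a d → toℚᵘ p ℚᵘ.≃ a /ᵘ d → toℚᵘ q ℚᵘ.≃ a /ᵘ d → p ≡ q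
    ℚ-≡ a d p≃ q≃ = ℚ.toℚᵘ-injective (ℚᵘ.≃-trans p≃ (ℚᵘ.≃-sym q≃))

  frac-cross : ∀ a d b e → frac a (suc d) ℚ.≤ frac b (suc e) → a ℕ.* suc e ≤ b ℕ.* suc d
  frac-cross a d b e le =
    /ᵘ-≤⁻ (ℚᵘ.≤-respˡ-≃ (toℚᵘ-frac a d) (ℚᵘ.≤-respʳ-≃ (toℚᵘ-frac b e) (ℚ.toℚᵘ-mono-≤ le)))

  ratℕ-mono-≤ : ∀ {a b} → a ≤ b → ratℕ a ℚ.≤ ratℕ b
  ratℕ-mono-≤ {a} {b} le = ℚ.toℚᵘ-cancel-≤
    (ℚᵘ.≤-respˡ-≃ (ℚᵘ.≃-sym (toℚᵘ-frac a 0)) (ℚᵘ.≤-respʳ-≃ (ℚᵘ.≃-sym (toℚᵘ-frac b 0))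
      (/ᵘ-≤⁺ (subst₂ _≤_ (sym (ℕ.*-identityʳ a)) (sym (ℕ.*-identityʳ b)) le))))

  ratℕ-+ : ∀ a b → ratℕ (a ℕ.+ b) ≡ ratℕ a ℚ.+ ratℕ b
  ratℕ-+ a b = ℚ-≡ (a ℕ.+ b) 0 (toℚᵘ-frac (a ℕ.+ b) 0) (ℚᵘ.≃-trans (ℚ.toℚᵘ-homo-+ (ratℕ a) (ratℕ b))
    (ℚᵘ.≃-trans (ℚᵘ.+-cong (toℚᵘ-frac a 0) (toℚᵘ-frac b 0))
      (ℚᵘ.≃-trans (ℚᵘ.≃-reflexive (+ᵘ-/ᵘ a 0 b 0)) (/ᵘ-≃ (cong (ℕ._* 1) (cong₂ ℕ._+_ (ℕ.*-identityʳ a) (ℕ.*-identityʳ b)))))))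

  ratℕ-* : ∀ a b → ratℕ (a ℕ.* b) ≡ ratℕ a ℚ.* ratℕ b
  ratℕ-* a b = ℚ-≡ (a ℕ.* b) 0 (toℚᵘ-frac (a ℕ.* b) 0) (ℚᵘ.≃-trans (ℚ.toℚᵘ-homo-* (ratℕ a) (ratℕ b))
    (ℚᵘ.≃-trans (ℚᵘ.*-cong (toℚᵘ-frac a 0) (toℚᵘ-frac b 0)) (ℚᵘ.≃-reflexive (*ᵘ-/ᵘ a 0 b 0))))

  frac*den : ∀ a d → frac a (suc d) ℚ.* ratℕ (suc d) ≡ ratℕ a
  frac*den a d = ℚ-≡ a 0 (ℚᵘ.≃-trans (ℚ.toℚᵘ-homo-* (frac a (suc d)) (ratℕ (suc d)))
      (ℚᵘ.≃-trans (ℚᵘ.*-cong (toℚᵘ-frac a d) (toℚᵘ-frac (suc d) 0))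
        (ℚᵘ.≃-trans (ℚᵘ.≃-reflexive (*ᵘ-/ᵘ a d (suc d) 0)) (/ᵘ-≃ (trans (ℕ.*-identityʳ _) (cong (λ x → a ℕ.* suc x) (sym (ℕ.*-identityʳ d))))))))
    (toℚᵘ-frac a 0)

  infixl 6 _⊕_
  infixl 7 _⊗_

  data ℕExpr : Set where
    ⌜_⌝     : ℕ → ℕExpr
    _⊕_ _⊗_ : ℕExpr → ℕExpr → ℕExpr

  ⟦_⟧ : ℕExpr → ℕ
  ⟦ ⌜ k ⌝ ⟧ = k
  ⟦ e ⊕ f ⟧ = ⟦ e ⟧ ℕ.+ ⟦ f ⟧
  ⟦ e ⊗ f ⟧ = ⟦ e ⟧ ℕ.* ⟦ f ⟧

  ⟦_⟧ℚ : ℕExpr → ℚ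
  ⟦ ⌜ k ⌝ ⟧ℚ = ratℕ k
  ⟦ e ⊕ f ⟧ℚ = ⟦ e ⟧ℚ ℚ.+ ⟦ f ⟧ℚ
  ⟦ e ⊗ f ⟧ℚ = ⟦ e ⟧ℚ ℚ.* ⟦ f ⟧ℚ

  ratℕ-⟦⟧ : ∀ e → ratℕ ⟦ e ⟧ ≡ ⟦ e ⟧ℚ
  ratℕ-⟦⟧ ⌜ k ⌝   = refl
  ratℕ-⟦⟧ (e ⊕ f) = trans (ratℕ-+ ⟦ e ⟧ ⟦ f ⟧) (cong₂ ℚ._+_ (ratℕ-⟦⟧ e) (ratℕ-⟦⟧ f))
  ratℕ-⟦⟧ (e ⊗ f) = trans (ratℕ-* ⟦ e ⟧ ⟦ f ⟧) (cong₂ ℚ._*_ (ratℕ-⟦⟧ e) (ratℕ-⟦⟧ f))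

  ratℕ-pred : ∀ Δ → ratℕ Δ ℚ.* ratℕ (Δ ℕ.∸ 1) ≡ ratℕ Δ ℚ.* ratℕ Δ ℚ.- ratℕ Δ
  ratℕ-pred zero    = refl
  ratℕ-pred (suc δ) rewrite ratℕ-+ 1 δ =
    solve 1 (λ x → (con ℚ.1ℚ :+ x) :* x := (con ℚ.1ℚ :+ x) :* (con ℚ.1ℚ :+ x) :- (con ℚ.1ℚ :+ x)) refl (ratℕ δ)
    where open ℚ-Solver using (solve; _:+_; _:*_; _:-_; _:=_; con)

  -- IsIsoMin with the minimum written as num / (1 + den-1) and its defining inequality cross-multiplied.
  record IsoRatio {n} (f : Subset n → ℕ) (x : ℚ) : Set where
    field
      num den-1        : ℕ
      x≡num/den        : x ≡ frac num (suc den-1)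
      cross-multiplied : ∀ S → 0 ℕ.< ∣ S ∣ → 2 ℕ.* ∣ S ∣ ≤ n → num ℕ.* ∣ S ∣ ≤ suc den-1 ℕ.* f S
      minimiser        : Subset n
      minimiser-value  : f minimiser ≡ num
      minimiser-size   : ∣ minimiser ∣ ≡ suc den-1
      minimiser-half   : 2 ℕ.* ∣ minimiser ∣ ≤ n

  IsIsoMin⇒IsoRatio : ∀ {n} {f : Subset n → ℕ} {x} → IsIsoMin f x → IsoRatio f x
  IsIsoMin⇒IsoRatio {f = f} ((S₀ , 0<|S₀| , half , x≡) , minimal) with ∣ S₀ ∣ in |S₀|
  ... | suc d = record
    { num = f S₀ ; den-1 = d ; x≡num/den = x≡
    ; cross-multiplied = λ S 0<|S| half′ → cross ∣ S ∣ 0<|S| (subst (ℚ._≤ frac (f S) ∣ S ∣) x≡ (minimal S 0<|S| half′))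
    ; minimiser = S₀ ; minimiser-value = refl ; minimiser-size = |S₀|
    ; minimiser-half = subst (λ k → 2 ℕ.* k ≤ _) (sym |S₀|) half
    }
    where
    cross : ∀ {b} k → 0 ℕ.< k → frac (f S₀) (suc d) ℚ.≤ frac b k → f S₀ ℕ.* k ≤ suc d ℕ.* b
    cross {b} (suc k) _ le = ℕ.≤-trans (frac-cross (f S₀) d b k le) (ℕ.≤-reflexive (ℕ.*-comm b (suc d)))

  IsoRatio⇒2≤n : ∀ {n} {f : Subset n → ℕ} {x} → IsoRatio f x → 2 ≤ n
  IsoRatio⇒2≤n R = ℕ.≤-trans (ℕ.*-monoʳ-≤ 2 (ℕ.≤-trans (s≤s z≤n) (ℕ.≤-reflexive (sym minimiser-size)))) minimiser-half
    where open IsoRatio R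

  module _ {n} (G : Graph n) {x : ℚ} where
    open Boundaries G

    edge-IsoBound : (R : IsoRatio (edgeBoundary G) x) → IsoBound edgeBoundaryᵇ (IsoRatio.num R) (suc (IsoRatio.den-1 R))
    edge-IsoBound R = IsoBound-tabulate edgeBoundary-lookup edgeBoundaryᵇ-≗ (IsoRatio.cross-multiplied R)

    vertex-IsoBound : (R : IsoRatio (vertexBoundary G) x) → IsoBound vertexBoundaryᵇ (IsoRatio.num R) (suc (IsoRatio.den-1 R))
    vertex-IsoBound R = IsoBound-tabulate vertexBoundary-lookup vertexBoundaryᵇ-≗ (IsoRatio.cross-multiplied R)

    edge-ratio≤maxDegree : (R : IsoRatio (edgeBoundary G) x) → IsoRatio.num R ≤ maxDegree G ℕ.* suc (IsoRatio.den-1 R)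
    edge-ratio≤maxDegree R = begin
      num                                           ≡⟨ minimiser-value ⟨
      edgeBoundary G minimiser                      ≡⟨ edgeBoundary-lookup minimiser ⟩
      edgeBoundaryᵇ (lookup minimiser)              ≤⟨ edgeBoundaryᵇ≤ (lookup minimiser) ⟩
      maxDegree G ℕ.* count (lookup minimiser)      ≡⟨ cong (maxDegree G ℕ.*_) (trans (sym (∣∣≡count-lookup minimiser)) minimiser-size) ⟩
      maxDegree G ℕ.* suc den-1                     ∎
      where
      open IsoRatio R
      open ℕ.≤-Reasoning

  -- Multiplied by the denominator of ι, each inequality becomes the ℕ inequality proved above.
  module ScaledBounds {m} {f : Subset m → ℕ} {ι : ℚ} (R : IsoRatio f ι) (n c Δ : ℕ) where
    open IsoRatio R using () renaming (num to a; den-1 to d; x≡num/den to ι≡a/σ)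
    open ℚ-Solver using (solve; _:+_; _:*_; _:-_; _:=_; con)

    private
      σ : ℚ
      σ = ratℕ (suc d)

      ι*σ : ι ℚ.* σ ≡ ratℕ a
      ι*σ = trans (cong (ℚ._* σ) ι≡a/σ) (frac*den a d)

      N C D : ℚ
      N = ratℕ n
      C = ratℕ c
      D = ratℕ Δ

    instance
      σ-pos : ℚ.Positive σ
      σ-pos = ℚ.normalize-pos (suc d) 1

    scaled-≤ : ∀ {p q} L R → p ℚ.* σ ≡ ⟦ L ⟧ℚ → q ℚ.* σ ≡ ⟦ R ⟧ℚ → ⟦ L ⟧ ≤ ⟦ R ⟧ → p ℚ.≤ q
    scaled-≤ L R pσ qσ L≤R = ℚ.*-cancelʳ-≤-pos σ
      (subst₂ ℚ._≤_ (trans (ratℕ-⟦⟧ L) (sym pσ)) (trans (ratℕ-⟦⟧ R) (sym qσ)) (ratℕ-mono-≤ L≤R))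

    ι*x*σ : ∀ x → (ι ℚ.* x) ℚ.* σ ≡ ratℕ a ℚ.* x
    ι*x*σ x = trans (solve 3 (λ i x s → (i :* x) :* s := (i :* s) :* x) refl ι x σ) (cong (ℚ._* x) ι*σ)

    edge-ratio : a ℕ.* n ≤ suc d ℕ.* (c ℕ.* (Δ ℕ.* (Δ ℕ.∸ 1))) ℕ.+ a ℕ.* (c ℕ.* (Δ ℕ.+ 1))
               → ι ℚ.* N ℚ.≤ C ℚ.* (D ℚ.* D ℚ.- D ℚ.+ ι ℚ.* (D ℚ.+ ratℕ 1))
    edge-ratio = scaled-≤ (⌜ a ⌝ ⊗ ⌜ n ⌝) (⌜ suc d ⌝ ⊗ (⌜ c ⌝ ⊗ (⌜ Δ ⌝ ⊗ ⌜ Δ ℕ.∸ 1 ⌝)) ⊕ ⌜ a ⌝ ⊗ (⌜ c ⌝ ⊗ (⌜ Δ ⌝ ⊕ ⌜ 1 ⌝)))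
      (ι*x*σ N)
      (begin
        C ℚ.* (D ℚ.* D ℚ.- D ℚ.+ ι ℚ.* (D ℚ.+ ratℕ 1)) ℚ.* σ
          ≡⟨ solve 5 (λ C X ι D s → C :* (X :+ ι :* (D :+ con ℚ.1ℚ)) :* s := s :* (C :* X) :+ (ι :* s) :* (C :* (D :+ con ℚ.1ℚ))) refl C (D ℚ.* D ℚ.- D) ι D σ ⟩
        σ ℚ.* (C ℚ.* (D ℚ.* D ℚ.- D)) ℚ.+ (ι ℚ.* σ) ℚ.* (C ℚ.* (D ℚ.+ ratℕ 1))
          ≡⟨ cong₂ (λ X y → σ ℚ.* (C ℚ.* X) ℚ.+ y ℚ.* (C ℚ.* (D ℚ.+ ratℕ 1))) (sym (ratℕ-pred Δ)) ι*σ ⟩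
        σ ℚ.* (C ℚ.* (D ℚ.* ratℕ (Δ ℕ.∸ 1))) ℚ.+ ratℕ a ℚ.* (C ℚ.* (D ℚ.+ ratℕ 1)) ∎)
      where open ≡-Reasoning

    vertex-ratio : a ℕ.* n ≤ 3 ℕ.* (suc d ℕ.* (c ℕ.* Δ)) ℕ.+ a ℕ.* (c ℕ.* (Δ ℕ.+ 1))
                 → ι ℚ.* N ℚ.≤ C ℚ.* (ratℕ 3 ℚ.* D ℚ.+ ι ℚ.* (D ℚ.+ ratℕ 1))
    vertex-ratio = scaled-≤ (⌜ a ⌝ ⊗ ⌜ n ⌝) (⌜ 3 ⌝ ⊗ (⌜ suc d ⌝ ⊗ (⌜ c ⌝ ⊗ ⌜ Δ ⌝)) ⊕ ⌜ a ⌝ ⊗ (⌜ c ⌝ ⊗ (⌜ Δ ⌝ ⊕ ⌜ 1 ⌝)))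
      (ι*x*σ N)
      (trans (solve 5 (λ C t ι D s → C :* (t :* D :+ ι :* (D :+ con ℚ.1ℚ)) :* s
                                     := t :* (s :* (C :* D)) :+ (ι :* s) :* (C :* (D :+ con ℚ.1ℚ))) refl C (ratℕ 3) ι D σ)
             (cong (λ y → ratℕ 3 ℚ.* (σ ℚ.* (C ℚ.* D)) ℚ.+ y ℚ.* (C ℚ.* (D ℚ.+ ratℕ 1))) ι*σ))

    quarter-ratio : a ℕ.* n ≤ 4 ℕ.* (suc d ℕ.* (c ℕ.* Δ)) → ι ℚ.* N ℚ.≤ C ℚ.* (ratℕ 4 ℚ.* D)
    quarter-ratio = scaled-≤ (⌜ a ⌝ ⊗ ⌜ n ⌝) (⌜ 4 ⌝ ⊗ (⌜ suc d ⌝ ⊗ (⌜ c ⌝ ⊗ ⌜ Δ ⌝)))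
      (ι*x*σ N)
      (solve 4 (λ C t D s → C :* (t :* D) :* s := t :* (s :* (C :* D))) refl C (ratℕ 4) D σ)

    edge-ratio-doubled : a ≤ Δ ℕ.* suc d
                       → (ι ℚ.* N) ℚ.* (D ℚ.* D ℚ.- D ℚ.+ ι ℚ.* (D ℚ.+ ratℕ 1))
                         ℚ.≤ (ι ℚ.* N) ℚ.* (ratℕ 2 ℚ.* (D ℚ.* D))
    edge-ratio-doubled a≤Δσ = ℚ.*-monoˡ-≤-nonNeg (ι ℚ.* N) {{ιN-nonNeg}} (begin
      D ℚ.* D ℚ.- D ℚ.+ ι ℚ.* (D ℚ.+ ratℕ 1)   ≤⟨ ℚ.+-monoʳ-≤ (D ℚ.* D ℚ.- D) ι[D+1]≤ ⟩
      D ℚ.* D ℚ.- D ℚ.+ (D ℚ.* D ℚ.+ D)        ≡⟨ solve 1 (λ D → D :* D :- D :+ (D :* D :+ D) := con (ratℕ 2) :* (D :* D)) refl D ⟩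
      ratℕ 2 ℚ.* (D ℚ.* D)                     ∎)
      where
      open ℚ.≤-Reasoning
      ιN-nonNeg : ℚ.NonNegative (ι ℚ.* N)
      ιN-nonNeg = ℚ.nonNeg*nonNeg⇒nonNeg ι {{subst ℚ.NonNegative (sym ι≡a/σ) (ℚ.normalize-nonNeg a (suc d))}}
                                         N {{ℚ.normalize-nonNeg n 1}}
      ι[D+1]≤ : ι ℚ.* (D ℚ.+ ratℕ 1) ℚ.≤ D ℚ.* D ℚ.+ D
      ι[D+1]≤ = scaled-≤ (⌜ a ⌝ ⊗ (⌜ Δ ⌝ ⊕ ⌜ 1 ⌝)) ((⌜ Δ ⌝ ⊗ ⌜ Δ ⌝ ⊕ ⌜ Δ ⌝) ⊗ ⌜ suc d ⌝) (ι*x*σ (D ℚ.+ ratℕ 1)) refl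
        (*-suc-mono a≤Δσ)

open import Data.Nat using (ℕ)
open import Data.Product using (_×_; _,_)
open import Data.Rational using (ℚ; _≤_; _*_; _+_; _-_)
open NaturalBounds using (module CopBounds)
open RationalBounds

theorem3p5 : ∀ {n : ℕ} (G : Graph n) → Connected G
    → ∀ (c : ℕ) → IsCopNumberInf G c
    → ∀ (ιe ιv : ℚ) → IsEdgeIsoNumber G ιe → IsVertexIsoNumber G ιv
    → ((ιe * ratℕ n ≤ ratℕ c * (ratℕ (maxDegree G) * ratℕ (maxDegree G) - ratℕ (maxDegree G) + ιe * (ratℕ (maxDegree G) + ratℕ 1)))
        × ((ιe * ratℕ n) * (ratℕ (maxDegree G) * ratℕ (maxDegree G) - ratℕ (maxDegree G) + ιe * (ratℕ (maxDegree G) + ratℕ 1))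
             ≤ (ιe * ratℕ n) * (ratℕ 2 * (ratℕ (maxDegree G) * ratℕ (maxDegree G)))))
      × (ιv * ratℕ n ≤ ratℕ c * (ratℕ 3 * ratℕ (maxDegree G) + ιv * (ratℕ (maxDegree G) + ratℕ 1)))
      × (ιv * ratℕ n ≤ ratℕ c * (ratℕ 4 * ratℕ (maxDegree G)))
theorem3p5 {n} G conn c (win , _) ιe ιv isoE isoV =
    (edge-ratio (edge-bound (edge-IsoBound G E)) , edge-ratio-doubled (edge-ratio≤maxDegree G E))
  , vertex-ratio (vertex-bound (vertex-IsoBound G V))
  , quarter-ratio (vertex-bound-quarter (vertex-IsoBound G V) conn (IsoRatio⇒2≤n V))
  where
  E = IsIsoMin⇒IsoRatio isoE
  V = IsIsoMin⇒IsoRatio isoV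
  open CopBounds G win
  open ScaledBounds E n c (maxDegree G) using (edge-ratio; edge-ratio-doubled)
  open ScaledBounds V n c (maxDegree G) using (vertex-ratio; quarter-ratio)
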